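{- Let $G$ be a minimal non-Pfaffian graph and $C$ a circuit of odd length in $G$ with vertex set $VC=\{v_1,\dots,v_n\}$. Suppose the graph $G^C$ obtained from $G$ by contracting $VC$ to a vertex $v$ is also non-Pfaffian. Then $\deg v=\sum_{i=1}^n\deg v_i-2n$. Moreover, every vertex $w\in VG-VC$ is a vertex of $G^C$ and $\deg_G w=\deg_{G^C}w$.
   Context: Graphs are finite, without loops or multiple edges. A graph is Pfaffian if it has an orientation in which all 1-factors (perfect matchings) have the same sign, the sign of $\{(u_1,w_1),\dots,(u_m,w_m)\}$ being the parity of the permutation $u_1w_1\cdots u_mw_m$ relative to a fixed 1-factor written likewise. $G$ is minimal non-Pfaffian if $G$ is non-Pfaffian and $G-e$ is Pfaffian for every edge $e$. In $G^C$ the neighbours of $v$ are the vertices outside $VC$ adjacent in $G$ to some vertex of $C$. -}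

module Defs where

open import Data.Nat using (ℕ; zero; suc; _+_; _<ᵇ_; _%_)
open import Data.Nat.DivMod using (_mod_)
open import Data.Fin using (Fin; toℕ)
open import Data.Bool using (Bool; true; false; not; if_then_else_)
open import Data.List using (List; []; _∷_; _++_; map; allFin; length)
open import Data.Nat.ListAction using (sum)
open import Data.Product using (Σ; ∃; _×_; _,_)
open import Relation.Binary.PropositionalEquality using (_≡_; _≢_)
open import Relation.Nullary using (¬_; Dec; yes; no)
open import Data.Fin using (_≟_)

Graph : ℕ → Set
Graph n = Fin n → Fin n → Bool

record IsSimple {n : ℕ} (G : Graph n) : Set where
  field
    sym    : ∀ u w → G u w ≡ G w u
    irrefl : ∀ u → G u u ≡ false

deg : ∀ {n} → Graph n → Fin n → ℕ
deg {n} G u = sum (map (λ w → if G u w then 1 else 0) (allFin n))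

isDec : ∀ {n} → Fin n → Fin n → Bool
isDec x y with x ≟ y
... | yes _ = true
... | no _  = false

deleteEdge : ∀ {n} → Graph n → Fin n → Fin n → Graph n
deleteEdge G u w x y =
  if (if isDec x u then isDec y w else false) then false
  else (if (if isDec x w then isDec y u else false) then false else G x y)

record PerfectMatching {n : ℕ} (G : Graph n) : Set where
  field
    mate     : Fin n → Fin n
    involut  : ∀ u → mate (mate u) ≡ u
    noFix    : ∀ u → mate u ≢ u
    isEdge   : ∀ u → G u (mate u) ≡ true
open PerfectMatching public

-- Orientation: o u w = true means the edge is directed u → w;
-- every edge gets exactly one direction.
IsOrientation : ∀ {n} → Graph n → (Fin n → Fin n → Bool) → Set
IsOrientation {n} G o = ∀ u w → G u w ≡ true → o w u ≡ not (o u w)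

-- The sequence u₁ w₁ … u_m w_m of a 1-factor, with each edge (uᵢ,wᵢ)
-- directed uᵢ → wᵢ (edges listed by increasing smaller endpoint).
matchSeq : ∀ {n} {G : Graph n} → (Fin n → Fin n → Bool) → PerfectMatching G → List (Fin n)
matchSeq {n} o M = go (allFin n)
  where
  go : List (Fin n) → List (Fin n)
  go [] = []
  go (u ∷ us) =
    (if toℕ u <ᵇ toℕ (mate M u)
       then (if o u (mate M u) then u ∷ mate M u ∷ [] else mate M u ∷ u ∷ [])
       else [])
    ++ go us

-- Number of inversions of a sequence (its parity = parity of the permutation).
inversions : ∀ {n} → List (Fin n) → ℕ
inversions [] = 0
inversions (x ∷ xs) = length (go xs) + inversions xs
  where
  go : List _ → List _
  go [] = []
  go (y ∷ ys) = if toℕ y <ᵇ toℕ x then y ∷ go ys else go ys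

sign : ∀ {n} {G : Graph n} → (Fin n → Fin n → Bool) → PerfectMatching G → ℕ
sign o M = inversions (matchSeq o M) % 2

-- Pfaffian: some orientation gives all 1-factors the same sign
-- (equivalently, the same sign relative to any fixed 1-factor).
Pfaffian : ∀ {n} → Graph n → Set
Pfaffian {n} G = Σ (Fin n → Fin n → Bool) λ o →
  IsOrientation G o × (∀ (M M' : PerfectMatching G) → sign o M ≡ sign o M')

MinimalNonPfaffian : ∀ {n} → Graph n → Set
MinimalNonPfaffian {n} G =
  IsSimple G × (¬ Pfaffian G) ×
  (∀ u w → G u w ≡ true → Pfaffian (deleteEdge G u w))

cycNext : ∀ {k} → Fin k → Fin k
cycNext {suc k} i = suc (toℕ i) mod (suc k)

record IsCircuit {n k : ℕ} (G : Graph n) (c : Fin k → Fin n) : Set where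
  field
    long   : 3 Data.Nat.≤ k
    inject : ∀ i j → c i ≡ c j → i ≡ j
    edges  : ∀ i → G (c i) (c (cycNext i)) ≡ true

InC : ∀ {n k} → (Fin k → Fin n) → Fin n → Set
InC c x = ∃ λ i → c i ≡ x

record IsContraction {n m k : ℕ} (G : Graph n) (c : Fin k → Fin n)
                     (H : Graph m) (φ : Fin n → Fin m) (v : Fin m) : Set where
  field
    onC      : ∀ x → InC c x → φ x ≡ v
    offC     : ∀ x → ¬ InC c x → φ x ≢ v
    injOff   : ∀ x y → ¬ InC c x → ¬ InC c y → φ x ≡ φ y → x ≡ y
    surj     : ∀ y → ∃ λ x → φ x ≡ y
    adjTo    : ∀ y z → H y z ≡ true →
                 (y ≢ z) × (∃ λ a → ∃ λ b → φ a ≡ y × φ b ≡ z × G a b ≡ true)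
    adjFrom  : ∀ y z → y ≢ z → ∀ a b → φ a ≡ y → φ b ≡ z → G a b ≡ true →
                 H y z ≡ true

{-# OPTIONS --safe #-}
module Submission where

-- Contracting an odd circuit C to a vertex v preserves Pfaffianity. A perfect matching of the
-- contraction H matches v with some y, and y has a neighbour c i on C; replacing v by c i and
-- adding the perfect matching c(i+1)c(i+2), …, c(i-2)c(i-1) of the even path C - c i lifts it to
-- a perfect matching of G. Direct the edges of H that avoid v as in G. Relabelling the vertices
-- and appending the path changes the sign by an amount depending only on i, so the edge vy can
-- be directed to cancel it; then every perfect matching of H has the sign of its lift.
--
-- So if G is minimal non-Pfaffian and H is not Pfaffian, no edge of G may disappear in the
-- contraction, for deleting it would leave a Pfaffian graph with the same contraction H. Hence C
-- has no chords and no vertex outside C has two neighbours on C. So each c i has exactly two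
-- neighbours on C, the remaining neighbours of the c i are pairwise distinct and φ maps them
-- bijectively onto the neighbours of v, and φ maps the neighbourhood of a vertex outside C
-- bijectively onto its neighbourhood in H.

open import Data.Bool using (Bool; true; false; not; _xor_; _∧_; if_then_else_) renaming (_≟_ to _≟ᵇ_)
open import Data.Bool.Properties
  using (T?; xor-assoc; xor-identityʳ; not-distribˡ-xor; not-involutive; ∧-distribʳ-xor)
open import Data.Bool.Solver using (module xor-∧-Solver)
open import Data.Empty using (⊥; ⊥-elim)
open import Data.Fin using (Fin; zero; toℕ; _≟_)
open import Data.Fin.Properties using (toℕ-injective; toℕ<n; toℕ-fromℕ<; any?)
open import Data.List
  using (List; []; _∷_; _++_; map; foldr; allFin; filter; filterᵇ; iterate; length; concatMap)
open import Data.List.Membership.Propositional using (_∈_; _∉_; lose)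
open import Data.List.Membership.Propositional.Properties
  using ( ∈-map⁺; ∈-map⁻; ∈-++⁺ˡ; ∈-++⁺ʳ; ∈-++⁻; ∈-filter⁺; ∈-filter⁻; ∈-allFin
        ; ∈-concatMap⁺; ∈-concatMap⁻)
open import Data.List.Membership.Propositional.Properties.WithK using (unique∧set⇒bag)
open import Data.List.Properties using (length-++; length-map; length-tabulate; map-cong)
open import Data.List.Relation.Binary.BagAndSetEquality using (∼bag⇒↭)
open import Data.List.Relation.Binary.Disjoint.Propositional using (Disjoint)
open import Data.List.Relation.Binary.Permutation.Propositional as ↭
  using (_↭_; prep; swap; ↭-sym; ↭-trans; ↭⇒↭ₛ)
open import Data.List.Relation.Binary.Permutation.Propositional.Properties
  using (shift; shifts; ++⁺ʳ; map⁺; ∈-resp-↭; ↭-length)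
import Data.List.Relation.Binary.Permutation.Setoid.Properties as ↭ₛ
open import Data.List.Relation.Unary.All as All using (All; []; _∷_)
import Data.List.Relation.Unary.All.Properties as All
open import Data.List.Relation.Unary.AllPairs as AllPairs using ([]; _∷_)
import Data.List.Relation.Unary.AllPairs.Properties as AllPairs
open import Data.List.Relation.Unary.Any as Any using (here; there)
open import Data.List.Relation.Unary.Unique.Propositional using (Unique)
import Data.List.Relation.Unary.Unique.Propositional.Properties as Unique
open import Data.Nat using (ℕ; zero; suc; _+_; _*_; _∸_; _<_; _≤_; _<ᵇ_; _%_; s≤s; z≤n; NonZero)
open import Data.Nat.DivMod using ([m+n]%n≡m%n; %-distribˡ-+; m%n%n≡m%n; m%n<n; m<n⇒m%n≡m)
open import Data.Nat.ListAction using (sum)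
import Data.Nat.Properties as ℕ
open import Algebra.Properties.CommutativeSemigroup ℕ.+-commutativeSemigroup
  using (x∙yz≈y∙xz; xy∙z≈y∙xz; interchange)
open import Data.Product using (_×_; _,_; ∃; proj₁; proj₂; uncurry)
open import Data.Sum using (_⊎_; inj₁; inj₂)
open import Function.Bundles using (mk⇔)
open import Relation.Binary.Definitions using (tri<; tri≈; tri>)
open import Relation.Binary.PropositionalEquality
  using (_≡_; _≢_; refl; sym; trans; cong; cong₂; subst; setoid; module ≡-Reasoning)
open import Relation.Nullary using (¬_; ¬?; Dec; yes; no; does; _×-dec_; _⊎-dec_)

open import Defs

open xor-∧-Solver using (solve; _:+_; _:=_; con)

private
  variable
    A B : Set

xor-exchange : ∀ a b c → a xor (b xor c) ≡ b xor (a xor c)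
xor-exchange = solve 3 (λ a b c → a :+ (b :+ c) := b :+ (a :+ c)) refl

xor-interchange : ∀ a b c d → (a xor b) xor (c xor d) ≡ (a xor c) xor (b xor d)
xor-interchange = solve 4 (λ a b c d → (a :+ b) :+ (c :+ d) := (a :+ c) :+ (b :+ d)) refl

not[x⊕y]≡true⇒x≡y : ∀ x y → not (x xor y) ≡ true → x ≡ y
not[x⊕y]≡true⇒x≡y false false _ = refl
not[x⊕y]≡true⇒x≡y true true _ = refl

x⊕y≡true⇒not-x≡y : ∀ x y → x xor y ≡ true → not x ≡ y
x⊕y≡true⇒not-x≡y false true _ = refl
x⊕y≡true⇒not-x≡y true false _ = refl

if-idem : ∀ b (x : A) → (if b then x else x) ≡ x
if-idem true x = refl
if-idem false x = refl

Unique-resp-↭ : {xs ys : List A} → xs ↭ ys → Unique xs → Unique ys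
Unique-resp-↭ {A = A} p = ↭ₛ.Unique-resp-↭ (setoid A) (↭⇒↭ₛ p)

unique-↭ : {xs ys : List A} → Unique xs → Unique ys →
  (∀ {z} → z ∈ xs → z ∈ ys) → (∀ {z} → z ∈ ys → z ∈ xs) → xs ↭ ys
unique-↭ ux uy f g = ∼bag⇒↭ (unique∧set⇒bag ux uy (mk⇔ f g))

Unique-map⁺-on : (f : A → B) {xs : List A} → (∀ {x y} → x ∈ xs → y ∈ xs → f x ≡ f y → x ≡ y) →
  Unique xs → Unique (map f xs)
Unique-map⁺-on f {[]} _ [] = []
Unique-map⁺-on f {x ∷ xs} f-inj (x∉ ∷ u) =
  All.tabulate (λ fy∈ fx≡fy → let (y , y∈ , fy≡) = ∈-map⁻ f fy∈ in
    All.lookup x∉ y∈ (f-inj (here refl) (there y∈) (trans fx≡fy fy≡))) ∷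
  Unique-map⁺-on f (λ x∈ y∈ → f-inj (there x∈) (there y∈)) u

length-concatMap : (f : A → List B) (xs : List A) → length (concatMap f xs) ≡ sum (map (λ x → length (f x)) xs)
length-concatMap f [] = refl
length-concatMap f (x ∷ xs) = trans (length-++ (f x)) (cong (length (f x) +_) (length-concatMap f xs))

sum-map-2+ : (f : A → ℕ) (xs : List A) → sum (map (λ x → 2 + f x) xs) ≡ 2 * length xs + sum (map f xs)
sum-map-2+ f [] = refl
sum-map-2+ f (x ∷ xs) = begin
  (2 + f x) + sum (map (λ x → 2 + f x) xs)    ≡⟨ cong ((2 + f x) +_) (sum-map-2+ f xs) ⟩
  (2 + f x) + (2 * length xs + sum (map f xs)) ≡⟨ interchange 2 (f x) (2 * length xs) _ ⟩
  (2 + 2 * length xs) + (f x + sum (map f xs)) ≡⟨ cong (_+ (f x + sum (map f xs))) (ℕ.*-suc 2 (length xs)) ⟨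
  2 * suc (length xs) + (f x + sum (map f xs)) ∎
  where open ≡-Reasoning

[m+n%d]%d≡[m+n]%d : ∀ m n d .{{_ : NonZero d}} → (m + n % d) % d ≡ (m + n) % d
[m+n%d]%d≡[m+n]%d m n d = begin
  (m + n % d) % d            ≡⟨ %-distribˡ-+ m (n % d) d ⟩
  (m % d + n % d % d) % d    ≡⟨ cong (λ t → (m % d + t) % d) (m%n%n≡m%n n d) ⟩
  (m % d + n % d) % d        ≡⟨ %-distribˡ-+ m n d ⟨
  (m + n) % d                ∎
  where open ≡-Reasoning

[m%d+n]%d≡[m+n]%d : ∀ m n d .{{_ : NonZero d}} → (m % d + n) % d ≡ (m + n) % d
[m%d+n]%d≡[m+n]%d m n d = begin
  (m % d + n) % d  ≡⟨ cong (_% d) (ℕ.+-comm (m % d) n) ⟩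
  (n + m % d) % d  ≡⟨ [m+n%d]%d≡[m+n]%d n m d ⟩
  (n + m) % d      ≡⟨ cong (_% d) (ℕ.+-comm n m) ⟩
  (m + n) % d      ∎
  where open ≡-Reasoning

n%2≡1⇒n≡suc[m+m] : ∀ n → n % 2 ≡ 1 → ∃ λ m → n ≡ suc (m + m)
n%2≡1⇒n≡suc[m+m] (suc zero) _ = 0 , refl
n%2≡1⇒n≡suc[m+m] (suc (suc n)) odd
  with n%2≡1⇒n≡suc[m+m] n (trans (sym ([m+n]%n≡m%n n 2)) (trans (cong (_% 2) (ℕ.+-comm n 2)) odd))
... | m , refl = suc m , cong (λ t → suc (suc t)) (sym (ℕ.+-suc m m))

-- Parities of lists

parity : (A → Bool) → List A → Bool
parity p [] = false
parity p (x ∷ xs) = p x xor parity p xs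

module _ (p : A → Bool) where

  parity-↭ : ∀ {xs ys} → xs ↭ ys → parity p xs ≡ parity p ys
  parity-↭ ↭.refl = refl
  parity-↭ (prep x q) = cong (p x xor_) (parity-↭ q)
  parity-↭ (swap x y q) rewrite parity-↭ q = xor-exchange (p x) (p y) _
  parity-↭ (↭.trans q r) = trans (parity-↭ q) (parity-↭ r)

  parity-++ : ∀ xs ys → parity p (xs ++ ys) ≡ parity p xs xor parity p ys
  parity-++ [] ys = refl
  parity-++ (x ∷ xs) ys rewrite parity-++ xs ys = sym (xor-assoc (p x) (parity p xs) (parity p ys))

  parity-map : (f : B → A) → ∀ xs → parity p (map f xs) ≡ parity (λ x → p (f x)) xs
  parity-map f [] = refl
  parity-map f (x ∷ xs) = cong (p (f x) xor_) (parity-map f xs)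

  parity-∧ʳ : ∀ b xs → parity (λ x → p x ∧ b) xs ≡ parity p xs ∧ b
  parity-∧ʳ b [] = refl
  parity-∧ʳ b (x ∷ xs) rewrite parity-∧ʳ b xs = sym (∧-distribʳ-xor b (p x) (parity p xs))

parity-cong : ∀ {p q : A → Bool} xs → (∀ {x} → x ∈ xs → p x ≡ q x) → parity p xs ≡ parity q xs
parity-cong [] p≗q = refl
parity-cong (x ∷ xs) p≗q = cong₂ _xor_ (p≗q (here refl)) (parity-cong xs (λ m → p≗q (there m)))

module _ {n : ℕ} (x : Fin n) where

  parity-≟-∉ : ∀ {xs} → x ∉ xs → parity (λ y → does (y ≟ x)) xs ≡ false
  parity-≟-∉ {[]} _ = refl
  parity-≟-∉ {y ∷ ys} x∉ with y ≟ x
  ... | yes refl with () ← x∉ (here refl)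
  ... | no _ = parity-≟-∉ (λ x∈ → x∉ (there x∈))

  parity-≟-unique : ∀ {xs} → Unique xs → x ∈ xs → parity (λ y → does (y ≟ x)) xs ≡ true
  parity-≟-unique {y ∷ ys} (y∉ ∷ _) x∈ with y ≟ x
  ... | yes refl = cong not (parity-≟-∉ (λ x∈ys → All.lookup y∉ x∈ys refl))
  parity-≟-unique {y ∷ ys} (_ ∷ u) (here refl) | no y≢x with () ← y≢x refl
  parity-≟-unique {y ∷ ys} (_ ∷ u) (there x∈) | no _ = parity-≟-unique u x∈

StrictTotalᵇ : (A → A → Bool) → Set
StrictTotalᵇ {A} lt = ∀ (x y : A) → x ≢ y → lt y x ≡ not (lt x y)

module _ (lt : A → A → Bool) where

  belowParity : A → List A → Bool
  belowParity x = parity (λ y → lt y x)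

  inversionParity : List A → Bool
  inversionParity [] = false
  inversionParity (x ∷ xs) = belowParity x xs xor inversionParity xs

  belowParity-↭ : ∀ x {ys zs} → ys ↭ zs → belowParity x ys ≡ belowParity x zs
  belowParity-↭ x = parity-↭ (λ y → lt y x)

  crossParity : List A → List A → Bool
  crossParity xs ys = parity (λ x → belowParity x ys) xs

  inversionParity-++ : ∀ xs ys →
    inversionParity (xs ++ ys) ≡ (inversionParity xs xor inversionParity ys) xor crossParity xs ys
  inversionParity-++ [] ys = sym (xor-identityʳ (inversionParity ys))
  inversionParity-++ (x ∷ xs) ys rewrite parity-++ (λ y → lt y x) xs ys | inversionParity-++ xs ys =
    solve 5 (λ bx by ix iy c → (bx :+ by) :+ ((ix :+ iy) :+ c) := ((bx :+ ix) :+ iy) :+ (by :+ c)) refl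
      (belowParity x xs) (belowParity x ys) (inversionParity xs) (inversionParity ys) (crossParity xs ys)

inversionParity-map : (lt : B → B → Bool) (f : A → B) →
  ∀ xs → inversionParity lt (map f xs) ≡ inversionParity (λ a b → lt (f a) (f b)) xs
inversionParity-map lt f [] = refl
inversionParity-map lt f (x ∷ xs) rewrite parity-map (λ y → lt y (f x)) f xs | inversionParity-map lt f xs = refl

orderDiscrepancy : (A → A → Bool) → (A → A → Bool) → List A → Bool
orderDiscrepancy lt₁ lt₂ xs = inversionParity lt₁ xs xor inversionParity lt₂ xs

-- Swapping two adjacent distinct entries flips the inversion parity for every strict total order.
orderDiscrepancy-↭ : {lt₁ lt₂ : A → A → Bool} → StrictTotalᵇ lt₁ → StrictTotalᵇ lt₂ →
  ∀ {xs ys} → Unique xs → xs ↭ ys → orderDiscrepancy lt₁ lt₂ xs ≡ orderDiscrepancy lt₁ lt₂ ys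
orderDiscrepancy-↭ t₁ t₂ u ↭.refl = refl
orderDiscrepancy-↭ {lt₁ = lt₁} {lt₂} t₁ t₂ {x ∷ xs} {x ∷ ys} (_ ∷ u) (prep x p)
  rewrite belowParity-↭ lt₁ x p | belowParity-↭ lt₂ x p = begin
    (b₁ xor inversionParity lt₁ xs) xor (b₂ xor inversionParity lt₂ xs)
      ≡⟨ xor-interchange b₁ _ b₂ _ ⟩
    (b₁ xor b₂) xor orderDiscrepancy lt₁ lt₂ xs
      ≡⟨ cong ((b₁ xor b₂) xor_) (orderDiscrepancy-↭ t₁ t₂ u p) ⟩
    (b₁ xor b₂) xor orderDiscrepancy lt₁ lt₂ ys
      ≡⟨ xor-interchange b₁ b₂ _ _ ⟩
    (b₁ xor inversionParity lt₁ ys) xor (b₂ xor inversionParity lt₂ ys) ∎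
  where
  open ≡-Reasoning
  b₁ = belowParity lt₁ x ys
  b₂ = belowParity lt₂ x ys
orderDiscrepancy-↭ {lt₁ = lt₁} {lt₂} t₁ t₂ {x ∷ y ∷ xs} {y ∷ x ∷ ys} ((x≢y ∷ _) ∷ _ ∷ u) (swap x y p)
  rewrite belowParity-↭ lt₁ x p | belowParity-↭ lt₂ x p | belowParity-↭ lt₁ y p | belowParity-↭ lt₂ y p
        | t₁ x y x≢y | t₂ x y x≢y = begin
    ((not a₁ xor c₁) xor (d₁ xor inversionParity lt₁ xs)) xor ((not a₂ xor c₂) xor (d₂ xor inversionParity lt₂ xs))
      ≡⟨ regroup a₁ a₂ c₁ c₂ d₁ d₂ _ _ ⟩
    κ xor orderDiscrepancy lt₁ lt₂ xs
      ≡⟨ cong (κ xor_) (orderDiscrepancy-↭ t₁ t₂ u p) ⟩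
    κ xor orderDiscrepancy lt₁ lt₂ ys
      ≡⟨ regroup′ a₁ a₂ c₁ c₂ d₁ d₂ _ _ ⟨
    ((a₁ xor d₁) xor (c₁ xor inversionParity lt₁ ys)) xor ((a₂ xor d₂) xor (c₂ xor inversionParity lt₂ ys)) ∎
  where
  open ≡-Reasoning
  a₁ = lt₁ x y
  a₂ = lt₂ x y
  c₁ = belowParity lt₁ x ys
  c₂ = belowParity lt₂ x ys
  d₁ = belowParity lt₁ y ys
  d₂ = belowParity lt₂ y ys
  κ = (a₁ xor a₂) xor ((c₁ xor c₂) xor (d₁ xor d₂))
  regroup : ∀ a₁ a₂ c₁ c₂ d₁ d₂ p₁ p₂ →
    ((not a₁ xor c₁) xor (d₁ xor p₁)) xor ((not a₂ xor c₂) xor (d₂ xor p₂))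
    ≡ ((a₁ xor a₂) xor ((c₁ xor c₂) xor (d₁ xor d₂))) xor (p₁ xor p₂)
  regroup = solve 8 (λ a₁ a₂ c₁ c₂ d₁ d₂ p₁ p₂ →
    (((con true :+ a₁) :+ c₁) :+ (d₁ :+ p₁)) :+ (((con true :+ a₂) :+ c₂) :+ (d₂ :+ p₂))
    := ((a₁ :+ a₂) :+ ((c₁ :+ c₂) :+ (d₁ :+ d₂))) :+ (p₁ :+ p₂)) refl
  regroup′ : ∀ a₁ a₂ c₁ c₂ d₁ d₂ p₁ p₂ →
    ((a₁ xor d₁) xor (c₁ xor p₁)) xor ((a₂ xor d₂) xor (c₂ xor p₂))
    ≡ ((a₁ xor a₂) xor ((c₁ xor c₂) xor (d₁ xor d₂))) xor (p₁ xor p₂)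
  regroup′ = solve 8 (λ a₁ a₂ c₁ c₂ d₁ d₂ p₁ p₂ →
    ((a₁ :+ d₁) :+ (c₁ :+ p₁)) :+ ((a₂ :+ d₂) :+ (c₂ :+ p₂))
    := ((a₁ :+ a₂) :+ ((c₁ :+ c₂) :+ (d₁ :+ d₂))) :+ (p₁ :+ p₂)) refl
orderDiscrepancy-↭ t₁ t₂ u (↭.trans p q) =
  trans (orderDiscrepancy-↭ t₁ t₂ u p) (orderDiscrepancy-↭ t₁ t₂ (Unique-resp-↭ p u) q)

flatten : List (A × A) → List A
flatten [] = []
flatten ((a , b) ∷ P) = a ∷ b ∷ flatten P

orient : (A → A → Bool) → A × A → A × A
orient o (a , b) = if o a b then (a , b) else (b , a)

misoriented : (A → A → Bool) → List (A × A) → Bool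
misoriented o = parity (λ (a , b) → not (o a b))

pmap : (A → B) → A × A → B × B
pmap f (a , b) = f a , f b

pairUp : (A → A) → List A → List (A × A)
pairUp f = map (λ x → x , f x)

pairsAlong : (A → A) → A → ℕ → List (A × A)
pairsAlong f x zero = []
pairsAlong f x (suc m) = (x , f x) ∷ pairsAlong f (f (f x)) m

flatten-↭ : {P Q : List (A × A)} → P ↭ Q → flatten P ↭ flatten Q
flatten-↭ ↭.refl = ↭.refl
flatten-↭ (prep (a , b) p) = prep a (prep b (flatten-↭ p))
flatten-↭ (swap (a , b) (c , d) p) =
  ↭-trans (shifts (a ∷ b ∷ []) (c ∷ d ∷ [])) (prep c (prep d (prep a (prep b (flatten-↭ p)))))
flatten-↭ (↭.trans p q) = ↭-trans (flatten-↭ p) (flatten-↭ q)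

flatten-orient-↭ : (o : A → A → Bool) (P : List (A × A)) → flatten (map (orient o) P) ↭ flatten P
flatten-orient-↭ o [] = ↭.refl
flatten-orient-↭ o ((a , b) ∷ P) with o a b
... | true = prep a (prep b (flatten-orient-↭ o P))
... | false = swap b a (flatten-orient-↭ o P)

flatten-pmap : (f : A → B) (P : List (A × A)) → flatten (map (pmap f) P) ≡ map f (flatten P)
flatten-pmap f [] = refl
flatten-pmap f ((a , b) ∷ P) = cong (λ l → f a ∷ f b ∷ l) (flatten-pmap f P)

flatten-++ : (P Q : List (A × A)) → flatten (P ++ Q) ≡ flatten P ++ flatten Q
flatten-++ [] Q = refl
flatten-++ ((a , b) ∷ P) Q = cong (λ l → a ∷ b ∷ l) (flatten-++ P Q)

flatten-pairUp-↭ : (f : A → A) (xs : List A) → flatten (pairUp f xs) ↭ xs ++ map f xs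
flatten-pairUp-↭ f [] = ↭.refl
flatten-pairUp-↭ f (x ∷ xs) =
  prep x (↭-trans (prep (f x) (flatten-pairUp-↭ f xs)) (↭-sym (shift (f x) xs (map f xs))))

flatten-pairsAlong : (f : A → A) (x : A) (m : ℕ) → flatten (pairsAlong f x m) ≡ iterate f x (m + m)
flatten-pairsAlong f x zero = refl
flatten-pairsAlong f x (suc m) rewrite ℕ.+-suc m m = cong (λ l → x ∷ f x ∷ l) (flatten-pairsAlong f (f (f x)) m)

∈-pairsAlong⁻ : ∀ {f : A → A} {x a b} m → (a , b) ∈ pairsAlong f x m → b ≡ f a
∈-pairsAlong⁻ (suc m) (here refl) = refl
∈-pairsAlong⁻ (suc m) (there ab∈) = ∈-pairsAlong⁻ m ab∈

parity-flatten : (p : A → Bool) (P : List (A × A)) → parity p (flatten P) ≡ parity (λ (a , b) → p a xor p b) P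
parity-flatten p [] = refl
parity-flatten p ((a , b) ∷ P) rewrite parity-flatten p P = sym (xor-assoc (p a) (p b) _)

∈-flatten-fst : ∀ {a b : A} {P} → (a , b) ∈ P → a ∈ flatten P
∈-flatten-fst {P = _ ∷ P} (here refl) = here refl
∈-flatten-fst {P = _ ∷ P} (there m) = there (there (∈-flatten-fst m))

∈-flatten-snd : ∀ {a b : A} {P} → (a , b) ∈ P → b ∈ flatten P
∈-flatten-snd {P = _ ∷ P} (here refl) = there (here refl)
∈-flatten-snd {P = _ ∷ P} (there m) = there (there (∈-flatten-snd m))

∈-flatten⁻ : ∀ {x : A} (P : List (A × A)) → x ∈ flatten P →
  ∃ λ q → q ∈ P × (x ≡ proj₁ q ⊎ x ≡ proj₂ q)
∈-flatten⁻ (q ∷ P) (here e) = q , here refl , inj₁ e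
∈-flatten⁻ (q ∷ P) (there (here e)) = q , here refl , inj₂ e
∈-flatten⁻ (q ∷ P) (there (there m)) with ∈-flatten⁻ P m
... | q′ , q′∈ , e = q′ , there q′∈ , e

Unique-flatten⇒Unique : {P : List (A × A)} → Unique (flatten P) → Unique P
Unique-flatten⇒Unique {P = []} u = []
Unique-flatten⇒Unique {P = (a , b) ∷ P} ((_ ∷ a∉) ∷ _ ∷ u) =
  All.tabulate (λ q∈ q≡ → All.lookup a∉ (∈-flatten-fst (subst (_∈ P) (sym q≡) q∈)) refl)
  ∷ Unique-flatten⇒Unique u

Unique-flatten⇒distinct : ∀ {a b : A} P → Unique (flatten P) → (a , b) ∈ P → a ≢ b
Unique-flatten⇒distinct (_ ∷ P) ((a≢b ∷ _) ∷ _) (here refl) = a≢b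
Unique-flatten⇒distinct (_ ∷ P) (_ ∷ _ ∷ u) (there m) = Unique-flatten⇒distinct P u m

module _ {lt : A → A → Bool} (strict : StrictTotalᵇ lt) where

  -- Moving a pair past another moves each of its two entries past two entries.
  inversionParity-flatten-↭ : {P Q : List (A × A)} → Unique (flatten P) → P ↭ Q →
    inversionParity lt (flatten P) ≡ inversionParity lt (flatten Q)
  inversionParity-flatten-↭ u ↭.refl = refl
  inversionParity-flatten-↭ (_ ∷ _ ∷ u) (prep (a , b) p)
    rewrite belowParity-↭ lt a (prep b (flatten-↭ p)) | belowParity-↭ lt b (flatten-↭ p)
          | inversionParity-flatten-↭ u p = refl
  inversionParity-flatten-↭ {(a , b) ∷ (c , d) ∷ P} {(c , d) ∷ (a , b) ∷ Q}
    ((_ ∷ a≢c ∷ a≢d ∷ _) ∷ (b≢c ∷ b≢d ∷ _) ∷ _ ∷ _ ∷ u) (swap (a , b) (c , d) p)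
    rewrite belowParity-↭ lt a (flatten-↭ p) | belowParity-↭ lt b (flatten-↭ p)
          | belowParity-↭ lt c (flatten-↭ p) | belowParity-↭ lt d (flatten-↭ p)
          | inversionParity-flatten-↭ u p
          | strict a c a≢c | strict a d a≢d | strict b c b≢c | strict b d b≢d =
    regroup (lt b a) (lt a c) (lt a d) (lt b c) (lt b d) (lt d c) _ _ _ _ _
    where
    regroup : ∀ ba ac ad bc bd dc pa pb pc pd i →
      (ba xor (not ac xor (not ad xor pa))) xor ((not bc xor (not bd xor pb)) xor ((dc xor pc) xor (pd xor i)))
      ≡ (dc xor (ac xor (bc xor pc))) xor ((ad xor (bd xor pd)) xor ((ba xor pa) xor (pb xor i)))
    regroup = solve 11 (λ ba ac ad bc bd dc pa pb pc pd i →
      (ba :+ ((con true :+ ac) :+ ((con true :+ ad) :+ pa))) :+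
        (((con true :+ bc) :+ ((con true :+ bd) :+ pb)) :+ ((dc :+ pc) :+ (pd :+ i)))
      := (dc :+ (ac :+ (bc :+ pc))) :+ ((ad :+ (bd :+ pd)) :+ ((ba :+ pa) :+ (pb :+ i)))) refl
  inversionParity-flatten-↭ u (↭.trans p q) =
    trans (inversionParity-flatten-↭ u p) (inversionParity-flatten-↭ (Unique-resp-↭ (flatten-↭ p) u) q)

  inversionParity-orient : (o : A → A → Bool) (P : List (A × A)) → Unique (flatten P) →
    inversionParity lt (flatten (map (orient o) P)) ≡ inversionParity lt (flatten P) xor misoriented o P
  inversionParity-orient o [] u = refl
  inversionParity-orient o ((a , b) ∷ P) ((a≢b ∷ _) ∷ _ ∷ u) with o a b
  ... | true rewrite belowParity-↭ lt a (prep b (flatten-orient-↭ o P))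
                   | belowParity-↭ lt b (flatten-orient-↭ o P) | inversionParity-orient o P u =
    solve 5 (λ x y z p f → (x :+ y) :+ (z :+ (p :+ f)) := ((x :+ y) :+ (z :+ p)) :+ f) refl
      (lt b a) (belowParity lt a (flatten P)) (belowParity lt b (flatten P))
      (inversionParity lt (flatten P)) (misoriented o P)
  ... | false rewrite belowParity-↭ lt b (prep a (flatten-orient-↭ o P))
                    | belowParity-↭ lt a (flatten-orient-↭ o P) | inversionParity-orient o P u | strict a b a≢b =
    solve 5 (λ l x y p f → (l :+ y) :+ (x :+ (p :+ f)) := (((con true :+ l) :+ x) :+ (y :+ p)) :+ (con true :+ f)) refl
      (lt a b) (belowParity lt a (flatten P)) (belowParity lt b (flatten P))
      (inversionParity lt (flatten P)) (misoriented o P)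

-- Signs of perfect matchings

<ᵇ-flip : ∀ m n → m ≢ n → (n <ᵇ m) ≡ not (m <ᵇ n)
<ᵇ-flip zero zero m≢n with () ← m≢n refl
<ᵇ-flip zero (suc n) _ = refl
<ᵇ-flip (suc m) zero _ = refl
<ᵇ-flip (suc m) (suc n) m≢n = <ᵇ-flip m n (λ e → m≢n (cong suc e))

ltᶠ : ∀ {n} → Fin n → Fin n → Bool
ltᶠ a b = toℕ a <ᵇ toℕ b

ltᶠ-strictTotal : ∀ {n} → StrictTotalᵇ (ltᶠ {n})
ltᶠ-strictTotal x y x≢y = <ᵇ-flip (toℕ x) (toℕ y) (λ e → x≢y (toℕ-injective e))

ltᶠ-on-strictTotal : ∀ {m n} (f : Fin m → Fin n) → (∀ {a b} → f a ≡ f b → a ≡ b) →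
  StrictTotalᵇ (λ a b → ltᶠ (f a) (f b))
ltᶠ-on-strictTotal f f-inj x y x≢y = ltᶠ-strictTotal (f x) (f y) (λ e → x≢y (f-inj e))

isOdd : ℕ → Bool
isOdd zero = false
isOdd (suc n) = not (isOdd n)

bit : Bool → ℕ
bit false = 0
bit true = 1

%2≡bit-isOdd : ∀ n → n % 2 ≡ bit (isOdd n)
%2≡bit-isOdd zero = refl
%2≡bit-isOdd (suc zero) = refl
%2≡bit-isOdd (suc (suc n)) = begin
  (2 + n) % 2  ≡⟨ cong (_% 2) (ℕ.+-comm 2 n) ⟩
  (n + 2) % 2  ≡⟨ [m+n]%n≡m%n n 2 ⟩
  n % 2        ≡⟨ %2≡bit-isOdd n ⟩
  bit (isOdd n) ≡⟨ cong bit (sym (not-involutive (isOdd n))) ⟩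
  bit (not (not (isOdd n))) ∎
  where open ≡-Reasoning

isOdd-+ : ∀ m n → isOdd (m + n) ≡ isOdd m xor isOdd n
isOdd-+ zero n = refl
isOdd-+ (suc m) n rewrite isOdd-+ m n = not-distribˡ-xor (isOdd m) (isOdd n)

countBelow : ∀ {n} → Fin n → List (Fin n) → ℕ
countBelow x [] = 0
countBelow x (y ∷ ys) = (if ltᶠ y x then 1 else 0) + countBelow x ys

isOdd-countBelow : ∀ {n} (x : Fin n) ys → isOdd (countBelow x ys) ≡ belowParity ltᶠ x ys
isOdd-countBelow x [] = refl
isOdd-countBelow x (y ∷ ys) with ltᶠ y x
... | true = cong not (isOdd-countBelow x ys)
... | false = isOdd-countBelow x ys

length-filterBelow : ∀ {n} (x : Fin n) (g : List (Fin n) → List (Fin n)) → g [] ≡ [] →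
  (∀ z zs → g (z ∷ zs) ≡ (if ltᶠ z x then z ∷ g zs else g zs)) →
  ∀ zs → foldr (λ _ → suc) 0 (g zs) ≡ countBelow x zs
length-filterBelow x g g[] g∷ [] = cong (foldr (λ _ → suc) 0) g[]
length-filterBelow x g g[] g∷ (z ∷ zs) rewrite g∷ z zs with ltᶠ z x
... | true = cong suc (length-filterBelow x g g[] g∷ zs)
... | false = length-filterBelow x g g[] g∷ zs

-- The helper that filters the entries below x is local to inversions; it is
-- determined here by its defining equations, and generalising the tail and
-- the length function lets Agda identify it with that helper.
inversions-∷ : ∀ {n} (x : Fin n) xs → inversions (x ∷ xs) ≡ countBelow x xs + inversions xs
inversions-∷ x xs with length-filterBelow x _ refl (λ _ _ → refl)
inversions-∷ x [] | _ = refl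
inversions-∷ x (y ∷ ys) | lemma with ys | y ∷ ys
... | S | P with ltᶠ y x
inversions-∷ {n} x (y ∷ ys) | lemma | S | P | true with foldr {A = Fin n} (λ _ → suc) 0 | lemma
... | len | lemma′ = cong (λ k → suc k + _) (lemma′ S)
inversions-∷ {n} x (y ∷ ys) | lemma | S | P | false with foldr {A = Fin n} (λ _ → suc) 0 | lemma
... | len | lemma′ = cong (_+ _) (lemma′ S)

isOdd-inversions : ∀ {n} (xs : List (Fin n)) → isOdd (inversions xs) ≡ inversionParity ltᶠ xs
isOdd-inversions [] = refl
isOdd-inversions (x ∷ xs)
  rewrite inversions-∷ x xs | isOdd-+ (countBelow x xs) (inversions xs)
        | isOdd-countBelow x xs | isOdd-inversions xs = refl

module _ {n : ℕ} {G : Graph n} (M : PerfectMatching G) where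

  mate-injective : ∀ {a b} → mate M a ≡ mate M b → a ≡ b
  mate-injective {a} {b} e = trans (sym (involut M a)) (trans (cong (mate M) e) (involut M b))

  lowerEnds : List (Fin n)
  lowerEnds = filterᵇ (λ u → ltᶠ u (mate M u)) (allFin n)

  ∈-lowerEnds⁻ : ∀ {u} → u ∈ lowerEnds → toℕ u < toℕ (mate M u)
  ∈-lowerEnds⁻ {u} u∈ =
    ℕ.<ᵇ⇒< (toℕ u) (toℕ (mate M u)) (proj₂ (∈-filter⁻ (λ u → T? (ltᶠ u (mate M u))) {xs = allFin n} u∈))

  ∈-lowerEnds⁺ : ∀ {u} → toℕ u < toℕ (mate M u) → u ∈ lowerEnds
  ∈-lowerEnds⁺ {u} lt = ∈-filter⁺ (λ u → T? (ltᶠ u (mate M u))) (∈-allFin u) (ℕ.<⇒<ᵇ lt)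

  matchedVertices-↭ : lowerEnds ++ map (mate M) lowerEnds ↭ allFin n
  matchedVertices-↭ =
    unique-↭ (Unique.++⁺ lowerEnds-unique (Unique.map⁺ mate-injective lowerEnds-unique) disjoint) (Unique.allFin⁺ n)
      (λ {z} _ → ∈-allFin z) (λ {z} _ → covered z)
    where
    lowerEnds-unique : Unique lowerEnds
    lowerEnds-unique = Unique.filter⁺ (λ u → T? (ltᶠ u (mate M u))) (Unique.allFin⁺ n)
    disjoint : ∀ {z} → ¬ (z ∈ lowerEnds × z ∈ map (mate M) lowerEnds)
    disjoint (z∈ , z∈′) with ∈-map⁻ (mate M) z∈′
    ... | y , y∈ , refl =
      ℕ.<-asym (∈-lowerEnds⁻ y∈) (subst (λ t → toℕ (mate M y) < toℕ t) (involut M y) (∈-lowerEnds⁻ z∈))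
    covered : ∀ z → z ∈ lowerEnds ++ map (mate M) lowerEnds
    covered z with ℕ.<-cmp (toℕ z) (toℕ (mate M z))
    ... | tri< lt _ _ = ∈-++⁺ˡ (∈-lowerEnds⁺ lt)
    ... | tri≈ _ eq _ with () ← noFix M z (sym (toℕ-injective eq))
    ... | tri> _ _ gt = ∈-++⁺ʳ lowerEnds (subst (_∈ map (mate M) lowerEnds) (involut M z)
      (∈-map⁺ (mate M) (∈-lowerEnds⁺ (subst (λ t → toℕ (mate M z) < toℕ t) (sym (involut M z)) gt))))

  matchEdges : List (Fin n × Fin n)
  matchEdges = pairUp (mate M) lowerEnds

  flatten-matchEdges-↭ : flatten matchEdges ↭ allFin n
  flatten-matchEdges-↭ = ↭-trans (flatten-pairUp-↭ (mate M) lowerEnds) matchedVertices-↭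

module _ {n : ℕ} {G : Graph n} (o : Fin n → Fin n → Bool) (M : PerfectMatching G) where

  matchPairs : List (Fin n × Fin n)
  matchPairs = map (orient o) (matchEdges M)

  flatten-matchPairs-↭ : flatten matchPairs ↭ allFin n
  flatten-matchPairs-↭ = ↭-trans (flatten-orient-↭ o (matchEdges M)) (flatten-matchEdges-↭ M)

  matchPairs-unique : Unique (flatten matchPairs)
  matchPairs-unique = Unique-resp-↭ (↭-sym flatten-matchPairs-↭) (Unique.allFin⁺ n)

  private
    seqStep : Fin n → List (Fin n)
    seqStep u = if ltᶠ u (mate M u)
      then (if o u (mate M u) then u ∷ mate M u ∷ [] else mate M u ∷ u ∷ [])
      else []

    seqOf : List (Fin n) → List (Fin n)
    seqOf us = flatten (map (orient o) (pairUp (mate M) (filterᵇ (λ u → ltᶠ u (mate M u)) us)))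

    recursion-seqOf : (g : List (Fin n) → List (Fin n)) → g [] ≡ [] →
      (∀ u us → g (u ∷ us) ≡ seqStep u ++ g us) → ∀ us → g us ≡ seqOf us
    recursion-seqOf g g[] g∷ [] = g[]
    recursion-seqOf g g[] g∷ (u ∷ us) rewrite g∷ u us with ltᶠ u (mate M u)
    ... | false = recursion-seqOf g g[] g∷ us
    ... | true with o u (mate M u)
    ...   | true = cong (λ l → u ∷ mate M u ∷ l) (recursion-seqOf g g[] g∷ us)
    ...   | false = cong (λ l → mate M u ∷ u ∷ l) (recursion-seqOf g g[] g∷ us)

  -- As for inversions-∷: matchSeq recurses through a local helper, pinned down by its equations.
  matchSeq≡flatten-matchPairs : matchSeq o M ≡ flatten matchPairs
  matchSeq≡flatten-matchPairs with allFin n | recursion-seqOf _ refl (λ _ _ → refl)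
  ... | us | lemma = lemma us

  sign≡inversionParity : sign o M ≡ bit (inversionParity ltᶠ (flatten matchPairs))
  sign≡inversionParity = trans (%2≡bit-isOdd (inversions (matchSeq o M)))
    (cong bit (trans (isOdd-inversions (matchSeq o M)) (cong (inversionParity ltᶠ) matchSeq≡flatten-matchPairs)))

  module _ (ori : IsOrientation G o) where

    ∈-matchPairs⁻ : ∀ {a b} → (a , b) ∈ matchPairs → mate M a ≡ b × o a b ≡ true
    ∈-matchPairs⁻ ab∈ with ∈-map⁻ (orient o) ab∈
    ... | q , q∈ , ab≡ with ∈-map⁻ (λ x → x , mate M x) q∈
    ... | u , _ , refl with o u (mate M u) in ou
    ... | true with refl ← ab≡ = refl , ou
    ... | false with refl ← ab≡ = involut M u , trans (ori u (mate M u) (isEdge M u)) (cong not ou)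

    ∈-matchPairs⁺ : ∀ {a b} → mate M a ≡ b → o a b ≡ true → (a , b) ∈ matchPairs
    ∈-matchPairs⁺ {a} refl oab with ℕ.<-cmp (toℕ a) (toℕ (mate M a))
    ... | tri< lt _ _ = subst (_∈ matchPairs) (orient-forward oab)
                          (∈-map⁺ (orient o) (∈-map⁺ (λ x → x , mate M x) (∈-lowerEnds⁺ M lt)))
      where
      orient-forward : o a (mate M a) ≡ true → orient o (a , mate M a) ≡ (a , mate M a)
      orient-forward e rewrite e = refl
    ... | tri≈ _ eq _ with () ← noFix M a (sym (toℕ-injective eq))
    ... | tri> _ _ gt = subst (_∈ matchPairs) orient-backward
                          (∈-map⁺ (orient o) (∈-map⁺ (λ x → x , mate M x) (∈-lowerEnds⁺ M mate-lower)))
      where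
      mate-lower : toℕ (mate M a) < toℕ (mate M (mate M a))
      mate-lower rewrite involut M a = gt
      orient-backward : orient o (mate M a , mate M (mate M a)) ≡ (a , mate M a)
      orient-backward rewrite involut M a | ori a (mate M a) (isEdge M a) | oab = refl

    sign-by-pairs : (Q : List (Fin n × Fin n)) → Unique (flatten Q) →
      (∀ {a b} → (a , b) ∈ Q → mate M a ≡ b × o a b ≡ true) →
      (∀ {a b} → mate M a ≡ b → o a b ≡ true → (a , b) ∈ Q) →
      sign o M ≡ bit (inversionParity ltᶠ (flatten Q))
    sign-by-pairs Q uQ Q⊆ ⊆Q = trans sign≡inversionParity
      (cong bit (inversionParity-flatten-↭ ltᶠ-strictTotal matchPairs-unique
        (unique-↭ (Unique-flatten⇒Unique matchPairs-unique) (Unique-flatten⇒Unique uQ)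
          (λ {(a , b)} m → let (mab , oab) = ∈-matchPairs⁻ m in ⊆Q mab oab)
          (λ {(a , b)} m → let (mab , oab) = Q⊆ m in ∈-matchPairs⁺ mab oab))))

module _ {n : ℕ} {G : Graph n} {o : Fin n → Fin n → Bool} where

  orient-edge : (∀ a b → G a b ≡ G b a) → ∀ {a b} → G a b ≡ true → uncurry G (orient o (a , b)) ≡ true
  orient-edge G-sym {a} {b} g with o a b
  ... | true = g
  ... | false = trans (G-sym b a) g

  orient-directed : IsOrientation G o → ∀ {a b} → G a b ≡ true → uncurry o (orient o (a , b)) ≡ true
  orient-directed ori {a} {b} g with o a b in oab
  ... | true = oab
  ... | false = trans (ori a b g) (cong not oab)

module _ {n : ℕ} {G : Graph n} (G-sym : ∀ a b → G a b ≡ G b a) where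

  partner : List (Fin n × Fin n) → Fin n → Fin n
  partner [] x = x
  partner ((a , b) ∷ P) x with x ≟ a | x ≟ b
  ... | yes _ | _ = b
  ... | no _ | yes _ = a
  ... | no _ | no _ = partner P x

  partner-fst : ∀ {a b} P → Unique (flatten P) → (a , b) ∈ P → partner P a ≡ b
  partner-fst {a} (_ ∷ P) _ (here refl) with a ≟ a
  ... | yes _ = refl
  ... | no a≢a with () ← a≢a refl
  partner-fst {a} ((a′ , b′) ∷ P) ((_ ∷ a′∉) ∷ b′∉ ∷ u) (there m) with a ≟ a′ | a ≟ b′
  ... | yes refl | _ with () ← All.lookup a′∉ (∈-flatten-fst m) refl
  ... | no _ | yes refl with () ← All.lookup b′∉ (∈-flatten-fst m) refl
  ... | no _ | no _ = partner-fst P u m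

  partner-snd : ∀ {a b} P → Unique (flatten P) → (a , b) ∈ P → partner P b ≡ a
  partner-snd {a} {b} (_ ∷ P) ((a≢b ∷ _) ∷ _) (here refl) with b ≟ a | b ≟ b
  ... | yes b≡a | _ with () ← a≢b (sym b≡a)
  ... | no _ | yes _ = refl
  ... | no _ | no b≢b with () ← b≢b refl
  partner-snd {a} {b} ((a′ , b′) ∷ P) ((_ ∷ a′∉) ∷ b′∉ ∷ u) (there m) with b ≟ a′ | b ≟ b′
  ... | yes refl | _ with () ← All.lookup a′∉ (∈-flatten-snd m) refl
  ... | no _ | yes refl with () ← All.lookup b′∉ (∈-flatten-snd m) refl
  ... | no _ | no _ = partner-snd P u m

  module _ (Q : List (Fin n × Fin n)) (Q-unique : Unique (flatten Q)) (Q-covers : ∀ x → x ∈ flatten Q)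
           (Q-edges : ∀ {a b} → (a , b) ∈ Q → G a b ≡ true) where

    fromPairs : PerfectMatching G
    fromPairs = record { mate = partner Q ; involut = involutive ; noFix = no-fixpoint ; isEdge = edge }
      where
      involutive : ∀ u → partner Q (partner Q u) ≡ u
      involutive u with ∈-flatten⁻ Q (Q-covers u)
      ... | _ , q∈ , inj₁ refl rewrite partner-fst Q Q-unique q∈ = partner-snd Q Q-unique q∈
      ... | _ , q∈ , inj₂ refl rewrite partner-snd Q Q-unique q∈ = partner-fst Q Q-unique q∈
      no-fixpoint : ∀ u → partner Q u ≢ u
      no-fixpoint u with ∈-flatten⁻ Q (Q-covers u)
      ... | _ , q∈ , inj₁ refl =
        λ e → Unique-flatten⇒distinct Q Q-unique q∈ (trans (sym e) (partner-fst Q Q-unique q∈))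
      ... | _ , q∈ , inj₂ refl =
        λ e → Unique-flatten⇒distinct Q Q-unique q∈ (trans (sym (partner-snd Q Q-unique q∈)) e)
      edge : ∀ u → G u (partner Q u) ≡ true
      edge u with ∈-flatten⁻ Q (Q-covers u)
      ... | _ , q∈ , inj₁ refl rewrite partner-fst Q Q-unique q∈ = Q-edges q∈
      ... | (a , b) , q∈ , inj₂ refl rewrite partner-snd Q Q-unique q∈ = trans (G-sym b a) (Q-edges q∈)

    sign-fromPairs : (o : Fin n → Fin n → Bool) → IsOrientation G o →
      (∀ {a b} → (a , b) ∈ Q → o a b ≡ true) → sign o fromPairs ≡ bit (inversionParity ltᶠ (flatten Q))
    sign-fromPairs o ori Q-oriented = sign-by-pairs o fromPairs ori Q Q-unique
      (λ q∈ → partner-fst Q Q-unique q∈ , Q-oriented q∈) complete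
      where
      complete : ∀ {a b} → partner Q a ≡ b → o a b ≡ true → (a , b) ∈ Q
      complete {a} e oab with ∈-flatten⁻ Q (Q-covers a)
      ... | _ , q∈ , inj₁ refl rewrite partner-fst Q Q-unique q∈ with refl ← e = q∈
      ... | (a′ , b′) , q∈ , inj₂ refl rewrite partner-snd Q Q-unique q∈ with refl ← e
          with () ← trans (sym oab) (trans (ori a′ b′ (Q-edges q∈)) (cong not (Q-oriented q∈)))

-- Positions on a circuit

module _ {k : ℕ} where

  rotate : Fin (suc k) → ℕ → Fin (suc k)
  rotate i zero = i
  rotate i (suc d) = cycNext (rotate i d)

  toℕ-rotate : ∀ i d → toℕ (rotate i d) ≡ (toℕ i + d) % suc k
  toℕ-rotate i zero = sym (trans (cong (_% suc k) (ℕ.+-identityʳ (toℕ i))) (m<n⇒m%n≡m (toℕ<n i)))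
  toℕ-rotate i (suc d) = begin
    toℕ (cycNext (rotate i d))      ≡⟨ toℕ-fromℕ< _ ⟩
    suc (toℕ (rotate i d)) % suc k  ≡⟨ cong (λ t → suc t % suc k) (toℕ-rotate i d) ⟩
    (1 + (toℕ i + d) % suc k) % suc k ≡⟨ [m+n%d]%d≡[m+n]%d 1 (toℕ i + d) (suc k) ⟩
    suc (toℕ i + d) % suc k         ≡⟨ cong (_% suc k) (ℕ.+-suc (toℕ i) d) ⟨
    (toℕ i + suc d) % suc k         ∎
    where open ≡-Reasoning

  rotate-suc : ∀ i d → rotate (cycNext i) d ≡ rotate i (suc d)
  rotate-suc i zero = refl
  rotate-suc i (suc d) = cong cycNext (rotate-suc i d)

  distance : Fin (suc k) → Fin (suc k) → ℕ
  distance i j = (toℕ j + (suc k ∸ toℕ i)) % suc k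

  distance<1+k : ∀ i j → distance i j < suc k
  distance<1+k i j = m%n<n (toℕ j + (suc k ∸ toℕ i)) (suc k)

  private
    i+[1+k∸i] : ∀ (i : Fin (suc k)) → toℕ i + (suc k ∸ toℕ i) ≡ suc k
    i+[1+k∸i] i = ℕ.m+[n∸m]≡n (ℕ.<⇒≤ (toℕ<n i))

  rotate-distance : ∀ i j → rotate i (distance i j) ≡ j
  rotate-distance i j = toℕ-injective (begin
    toℕ (rotate i (distance i j))                        ≡⟨ toℕ-rotate i (distance i j) ⟩
    (toℕ i + (toℕ j + (suc k ∸ toℕ i)) % suc k) % suc k  ≡⟨ [m+n%d]%d≡[m+n]%d (toℕ i) _ (suc k) ⟩
    (toℕ i + (toℕ j + (suc k ∸ toℕ i))) % suc k          ≡⟨ cong (_% suc k) (x∙yz≈y∙xz (toℕ i) (toℕ j) _) ⟩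
    (toℕ j + (toℕ i + (suc k ∸ toℕ i))) % suc k          ≡⟨ cong (λ t → (toℕ j + t) % suc k) (i+[1+k∸i] i) ⟩
    (toℕ j + suc k) % suc k                              ≡⟨ [m+n]%n≡m%n (toℕ j) (suc k) ⟩
    toℕ j % suc k                                        ≡⟨ m<n⇒m%n≡m (toℕ<n j) ⟩
    toℕ j                                                ∎)
    where open ≡-Reasoning

  distance-rotate : ∀ i {d} → d < suc k → distance i (rotate i d) ≡ d
  distance-rotate i {d} d<1+k = begin
    (toℕ (rotate i d) + (suc k ∸ toℕ i)) % suc k     ≡⟨ cong (λ t → (t + (suc k ∸ toℕ i)) % suc k) (toℕ-rotate i d) ⟩
    ((toℕ i + d) % suc k + (suc k ∸ toℕ i)) % suc k  ≡⟨ [m%d+n]%d≡[m+n]%d (toℕ i + d) _ (suc k) ⟩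
    (toℕ i + d + (suc k ∸ toℕ i)) % suc k            ≡⟨ cong (_% suc k) (xy∙z≈y∙xz (toℕ i) d _) ⟩
    (d + (toℕ i + (suc k ∸ toℕ i))) % suc k          ≡⟨ cong (λ t → (d + t) % suc k) (i+[1+k∸i] i) ⟩
    (d + suc k) % suc k                              ≡⟨ [m+n]%n≡m%n d (suc k) ⟩
    d % suc k                                        ≡⟨ m<n⇒m%n≡m d<1+k ⟩
    d                                                ∎
    where open ≡-Reasoning

  rotate-injective : ∀ i {d₁ d₂} → d₁ < suc k → d₂ < suc k → rotate i d₁ ≡ rotate i d₂ → d₁ ≡ d₂
  rotate-injective i d₁< d₂< e =
    trans (sym (distance-rotate i d₁<)) (trans (cong (distance i) e) (distance-rotate i d₂<))

  cycPrev : Fin (suc k) → Fin (suc k)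
  cycPrev i = rotate i k

  cycNext-cycPrev : ∀ i → cycNext (cycPrev i) ≡ i
  cycNext-cycPrev i = toℕ-injective (trans (toℕ-rotate i (suc k))
    (trans ([m+n]%n≡m%n (toℕ i) (suc k)) (m<n⇒m%n≡m (toℕ<n i))))

  cycPrev-cycNext : ∀ i → cycPrev (cycNext i) ≡ i
  cycPrev-cycNext i = trans (rotate-suc i k) (cycNext-cycPrev i)

  cycNext≢cycPrev : 2 ≤ k → ∀ i → cycNext i ≢ cycPrev i
  cycNext≢cycPrev 2≤k i e =
    ℕ.<⇒≢ 2≤k (rotate-injective i (s≤s (ℕ.≤-trans (s≤s z≤n) 2≤k)) (ℕ.n<1+n k) e)

  ∈-iterate-cycNext⁻ : ∀ {j x} n → x ∈ iterate cycNext j n → ∃ λ d → d < n × x ≡ rotate j d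
  ∈-iterate-cycNext⁻ (suc n) (here refl) = 0 , s≤s z≤n , refl
  ∈-iterate-cycNext⁻ {j} (suc n) (there x∈) with ∈-iterate-cycNext⁻ n x∈
  ... | d , d<n , refl = suc d , s≤s d<n , rotate-suc j d

  ∈-iterate-cycNext⁺ : ∀ j {d} n → d < n → rotate j d ∈ iterate cycNext j n
  ∈-iterate-cycNext⁺ j {zero} (suc n) _ = here refl
  ∈-iterate-cycNext⁺ j {suc d} (suc n) (s≤s d<n) =
    there (subst (_∈ iterate cycNext (cycNext j) n) (rotate-suc j d) (∈-iterate-cycNext⁺ (cycNext j) n d<n))

  iterate-cycNext-unique : ∀ j n → n ≤ suc k → Unique (iterate cycNext j n)
  iterate-cycNext-unique j zero _ = []
  iterate-cycNext-unique j (suc n) n<1+k =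
    All.tabulate j∉ ∷ iterate-cycNext-unique (cycNext j) n (ℕ.<⇒≤ n<1+k)
    where
    j∉ : ∀ {x} → x ∈ iterate cycNext (cycNext j) n → j ≢ x
    j∉ x∈ j≡x with ∈-iterate-cycNext⁻ n x∈
    ... | d , d<n , x≡ with () ← rotate-injective j {0} {suc d} (s≤s z≤n) (ℕ.<-≤-trans (s≤s d<n) n<1+k)
                                   (trans j≡x (trans x≡ (rotate-suc j d)))

-- Contracting an odd circuit

φ≡v⇒InC : ∀ {N M k} {G : Graph N} {c : Fin k → Fin N} {H : Graph M} {φ v} →
  IsContraction G c H φ v → ∀ x → φ x ≡ v → InC c x
φ≡v⇒InC {c = c} contraction x φx≡v with any? (λ i → c i ≟ x)
... | yes x∈C = x∈C
... | no x∉C with () ← IsContraction.offC contraction x x∉C φx≡v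

module OddCircuitContraction
  {N M m : ℕ} {G : Graph N} {c : Fin (suc (m + m)) → Fin N} {H : Graph M} {φ : Fin N → Fin M} {v : Fin M}
  (G-sym : ∀ a b → G a b ≡ G b a) (circuit : IsCircuit G c) (contraction : IsContraction G c H φ v)
  where

  open IsContraction contraction
  open IsCircuit circuit using (inject; edges)

  preimage : Fin M → Fin N
  preimage y = proj₁ (surj y)

  φ-preimage : ∀ y → φ (preimage y) ≡ y
  φ-preimage y = proj₂ (surj y)

  preimage-∉C : ∀ {y} → y ≢ v → ¬ InC c (preimage y)
  preimage-∉C {y} y≢v x∈C = y≢v (trans (sym (φ-preimage y)) (onC (preimage y) x∈C))

  ≡preimage : ∀ {a y} → φ a ≡ y → y ≢ v → a ≡ preimage y
  ≡preimage {a} {y} φa≡y y≢v = injOff a (preimage y) (λ a∈C → y≢v (trans (sym φa≡y) (onC a a∈C)))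
    (preimage-∉C y≢v) (trans φa≡y (sym (φ-preimage y)))

  preimage-edge : ∀ {y z} → y ≢ v → z ≢ v → H y z ≡ true → G (preimage y) (preimage z) ≡ true
  preimage-edge {y} {z} y≢v z≢v h with adjTo y z h
  ... | _ , a , b , φa≡y , φb≡z , g
    rewrite ≡preimage φa≡y y≢v | ≡preimage φb≡z z≢v = g

  -- The fallback zero is a junk value: it is used only when v y is not an edge of H.
  attachment : Fin M → Fin (suc (m + m))
  attachment y with any? (λ i → G (c i) (preimage y) ≟ᵇ true)
  ... | yes (i , _) = i
  ... | no _ = zero

  attachment-edge : ∀ {y} → H v y ≡ true → G (c (attachment y)) (preimage y) ≡ true
  attachment-edge {y} h with any? (λ i → G (c i) (preimage y) ≟ᵇ true)
  ... | yes (_ , g) = g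
  ... | no no-attachment with adjTo v y h
  ...   | v≢y , a , b , φa≡v , φb≡y , g with φ≡v⇒InC contraction a φa≡v
  ...     | i , refl rewrite ≡preimage φb≡y (λ y≡v → v≢y (sym y≡v)) with () ← no-attachment (i , g)

  expandAt : Fin (suc (m + m)) → Fin M → Fin N
  expandAt i y with y ≟ v
  ... | yes _ = c i
  ... | no _ = preimage y

  expandAt-v : ∀ i → expandAt i v ≡ c i
  expandAt-v i with v ≟ v
  ... | yes _ = refl
  ... | no v≢v with () ← v≢v refl

  expandAt-≢v : ∀ i {y} → y ≢ v → expandAt i y ≡ preimage y
  expandAt-≢v i {y} y≢v with y ≟ v
  ... | yes y≡v with () ← y≢v y≡v
  ... | no _ = refl

  expandAt-injective : ∀ i {a b} → expandAt i a ≡ expandAt i b → a ≡ b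
  expandAt-injective i {a} {b} e with a ≟ v | b ≟ v
  ... | yes a≡v | yes b≡v = trans a≡v (sym b≡v)
  ... | yes _ | no b≢v with () ← preimage-∉C b≢v (i , e)
  ... | no a≢v | yes _ with () ← preimage-∉C a≢v (i , sym e)
  ... | no _ | no _ = trans (sym (φ-preimage a)) (trans (cong φ e) (φ-preimage b))

  path : Fin (suc (m + m)) → List (Fin (suc (m + m)))
  path i = iterate cycNext (cycNext i) (m + m)

  pathPairs : Fin (suc (m + m)) → List (Fin N × Fin N)
  pathPairs i = map (pmap c) (pairsAlong cycNext (cycNext i) m)

  flatten-pathPairs : ∀ i → flatten (pathPairs i) ≡ map c (path i)
  flatten-pathPairs i = trans (flatten-pmap c (pairsAlong cycNext (cycNext i) m))
    (cong (map c) (flatten-pairsAlong cycNext (cycNext i) m))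

  pathPairs-edges : ∀ i {a b} → (a , b) ∈ pathPairs i → G a b ≡ true
  pathPairs-edges i ab∈ with ∈-map⁻ (pmap c) ab∈
  ... | (j , j′) , jj′∈ , refl rewrite ∈-pairsAlong⁻ m jj′∈ = edges j

  vertices-↭ : ∀ i → map (expandAt i) (allFin M) ++ map c (path i) ↭ allFin N
  vertices-↭ i = unique-↭
    (Unique.++⁺ (Unique.map⁺ (expandAt-injective i) (Unique.allFin⁺ M))
                (Unique.map⁺ (inject _ _) (iterate-cycNext-unique (cycNext i) (m + m) (ℕ.n≤1+n (m + m))))
                disjoint)
    (Unique.allFin⁺ N) (λ {z} _ → ∈-allFin z) (λ {z} _ → covered z)
    where
    ∈path⇒rotate : ∀ {j} → j ∈ path i → ∃ λ d → d < m + m × j ≡ rotate i (suc d)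
    ∈path⇒rotate j∈ with ∈-iterate-cycNext⁻ (m + m) j∈
    ... | d , d< , refl = d , d< , rotate-suc i d
    disjoint : ∀ {z} → ¬ (z ∈ map (expandAt i) (allFin M) × z ∈ map c (path i))
    disjoint (z∈ , z∈′) with ∈-map⁻ (expandAt i) z∈ | ∈-map⁻ c z∈′
    ... | y , _ , refl | j , j∈ , e with y ≟ v
    ...   | no y≢v with () ← preimage-∉C y≢v (j , sym e)
    ...   | yes refl with ∈path⇒rotate j∈
    ...     | d , d< , refl with () ← rotate-injective i {0} {suc d} (s≤s z≤n) (s≤s d<)
                                     (inject _ _ e)
    covered : ∀ z → z ∈ map (expandAt i) (allFin M) ++ map c (path i)
    covered z with any? (λ j → c j ≟ z)
    ... | no z∉C = ∈-++⁺ˡ (subst (_∈ map (expandAt i) (allFin M))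
                     (trans (expandAt-≢v i (offC z z∉C)) (sym (≡preimage refl (offC z z∉C))))
                     (∈-map⁺ (expandAt i) (∈-allFin (φ z))))
    ... | yes (j , refl) with distance i j in dist | rotate-distance i j
    ...   | zero | j≡i = ∈-++⁺ˡ (subst (_∈ map (expandAt i) (allFin M)) (trans (expandAt-v i) (cong c j≡i))
                           (∈-map⁺ (expandAt i) (∈-allFin v)))
    ...   | suc d | j≡ = ∈-++⁺ʳ (map (expandAt i) (allFin M))
                           (∈-map⁺ c (subst (_∈ path i) (trans (rotate-suc i d) j≡)
                             (∈-iterate-cycNext⁺ (cycNext i) (m + m) d<m+m)))
      where
      d<m+m : d < m + m
      d<m+m = ℕ.≤-pred (subst (_< suc (m + m)) dist (distance<1+k i j))

  module _ (o : Fin N → Fin N → Bool) (ori : IsOrientation G o) where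

    expandedOrder : Fin (suc (m + m)) → Fin M → Fin M → Bool
    expandedOrder i a b = ltᶠ (expandAt i a) (expandAt i b)

    -- The change of sign caused by lifting through c i, not counting the edge at v; the edge
    -- from v to a vertex attached at c i is directed so as to cancel it.
    defect : Fin (suc (m + m)) → Bool
    defect i = ((orderDiscrepancy ltᶠ (expandedOrder i) (allFin M)
                 xor inversionParity ltᶠ (flatten (pathPairs i)))
                 xor crossParity ltᶠ (map (expandAt i) (allFin M)) (flatten (pathPairs i)))
                 xor misoriented o (pathPairs i)

    intoV : Fin M → Bool
    intoV y = o (preimage y) (c (attachment y)) xor defect (attachment y)

    contractedOrientation : Fin M → Fin M → Bool
    contractedOrientation y z with y ≟ v | z ≟ v
    ... | yes _ | yes _ = false
    ... | yes _ | no _ = not (intoV z)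
    ... | no _ | yes _ = intoV y
    ... | no _ | no _ = o (preimage y) (preimage z)

    contractedOrientation-isOrientation : IsOrientation H contractedOrientation
    contractedOrientation-isOrientation y z h with y ≟ v | z ≟ v
    ... | yes refl | yes refl with () ← proj₁ (adjTo v v h) refl
    ... | yes _ | no _ = sym (not-involutive (intoV z))
    ... | no _ | yes _ = refl
    ... | no y≢v | no z≢v = ori (preimage y) (preimage z) (preimage-edge y≢v z≢v h)

    module Lift (MH : PerfectMatching H) where

      w : Fin M
      w = mate MH v

      i : Fin (suc (m + m))
      i = attachment w

      pairsH : List (Fin M × Fin M)
      pairsH = matchPairs contractedOrientation MH

      expandedPairs : List (Fin N × Fin N)
      expandedPairs = map (pmap (expandAt i)) pairsH

      Q₀ : List (Fin N × Fin N)
      Q₀ = expandedPairs ++ pathPairs i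

      Q : List (Fin N × Fin N)
      Q = map (orient o) Q₀

      flatten-Q₀ : flatten Q₀ ≡ map (expandAt i) (flatten pairsH) ++ flatten (pathPairs i)
      flatten-Q₀ = trans (flatten-++ expandedPairs (pathPairs i))
        (cong (_++ flatten (pathPairs i)) (flatten-pmap (expandAt i) pairsH))

      flatten-Q₀-↭ : flatten Q₀ ↭ allFin N
      flatten-Q₀-↭ rewrite flatten-Q₀ | flatten-pathPairs i =
        ↭-trans (++⁺ʳ (map c (path i)) (map⁺ (expandAt i) (flatten-matchPairs-↭ contractedOrientation MH)))
                (vertices-↭ i)

      Q₀-unique : Unique (flatten Q₀)
      Q₀-unique = Unique-resp-↭ (↭-sym flatten-Q₀-↭) (Unique.allFin⁺ N)

      flatten-Q-↭ : flatten Q ↭ allFin N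
      flatten-Q-↭ = ↭-trans (flatten-orient-↭ o Q₀) flatten-Q₀-↭

      Q-unique : Unique (flatten Q)
      Q-unique = Unique-resp-↭ (↭-sym flatten-Q-↭) (Unique.allFin⁺ N)

      Q-covers : ∀ x → x ∈ flatten Q
      Q-covers x = ∈-resp-↭ (↭-sym flatten-Q-↭) (∈-allFin x)

      pairsH-sound : ∀ {a b} → (a , b) ∈ pairsH → mate MH a ≡ b × contractedOrientation a b ≡ true
      pairsH-sound = ∈-matchPairs⁻ contractedOrientation MH contractedOrientation-isOrientation

      mate≡v⇒≡w : ∀ {a} → mate MH a ≡ v → a ≡ w
      mate≡v⇒≡w {a} e = trans (sym (involut MH a)) (cong (mate MH) e)

      pairsH-edges : ∀ {a b} → (a , b) ∈ pairsH → G (expandAt i a) (expandAt i b) ≡ true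
      pairsH-edges {a} {b} ab∈ with pairsH-sound ab∈
      ... | mate-a , _ with a ≟ v | b ≟ v
      ...   | yes refl | yes refl with () ← noFix MH v mate-a
      ...   | yes refl | no _ rewrite sym mate-a = attachment-edge (isEdge MH v)
      ...   | no _ | yes refl rewrite mate≡v⇒≡w mate-a =
        trans (G-sym (preimage w) (c i)) (attachment-edge (isEdge MH v))
      ...   | no a≢v | no b≢v = preimage-edge a≢v b≢v (subst (λ t → H a t ≡ true) mate-a (isEdge MH a))

      Q₀-edges : ∀ {q} → q ∈ Q₀ → uncurry G q ≡ true
      Q₀-edges q∈ with ∈-++⁻ expandedPairs q∈
      ... | inj₂ q∈path = pathPairs-edges i q∈path
      ... | inj₁ q∈exp with ∈-map⁻ (pmap (expandAt i)) q∈exp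
      ...   | _ , ab∈ , refl = pairsH-edges ab∈

      Q-edges : ∀ {a b} → (a , b) ∈ Q → G a b ≡ true
      Q-edges ab∈ with ∈-map⁻ (orient o) ab∈
      ... | _ , q∈ , refl = orient-edge {o = o} G-sym (Q₀-edges q∈)

      Q-directed : ∀ {a b} → (a , b) ∈ Q → o a b ≡ true
      Q-directed ab∈ with ∈-map⁻ (orient o) ab∈
      ... | _ , q∈ , refl = orient-directed ori (Q₀-edges q∈)

      lift : PerfectMatching G
      lift = fromPairs G-sym Q Q-unique Q-covers Q-edges

      isV : Fin M → Bool
      isV y = does (y ≟ v)

      misoriented-pair : ∀ {a b} → (a , b) ∈ pairsH →
        not (o (expandAt i a) (expandAt i b)) ≡ (isV a xor isV b) ∧ defect i
      misoriented-pair {a} {b} ab∈ with pairsH-sound ab∈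
      ... | mate-a , directed with a ≟ v | b ≟ v
      ...   | yes refl | yes refl with () ← noFix MH v mate-a
      ...   | yes refl | no _ rewrite sym mate-a =
        trans (sym (ori (c i) (preimage w) (attachment-edge (isEdge MH v))))
              (not[x⊕y]≡true⇒x≡y _ _ directed)
      ...   | no _ | yes refl rewrite mate≡v⇒≡w mate-a = x⊕y≡true⇒not-x≡y _ _ directed
      ...   | no _ | no _ = cong not directed

      misoriented-expandedPairs : misoriented o expandedPairs ≡ defect i
      misoriented-expandedPairs = begin
        misoriented o expandedPairs
          ≡⟨ parity-map (λ (a , b) → not (o a b)) (pmap (expandAt i)) pairsH ⟩
        parity (λ (a , b) → not (o (expandAt i a) (expandAt i b))) pairsH
          ≡⟨ parity-cong pairsH (λ {(a , b)} → misoriented-pair) ⟩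
        parity (λ (a , b) → (isV a xor isV b) ∧ defect i) pairsH
          ≡⟨ parity-∧ʳ (λ (a , b) → isV a xor isV b) (defect i) pairsH ⟩
        parity (λ (a , b) → isV a xor isV b) pairsH ∧ defect i
          ≡⟨ cong (_∧ defect i) (parity-flatten isV pairsH) ⟨
        parity isV (flatten pairsH) ∧ defect i
          ≡⟨ cong (_∧ defect i) (parity-↭ isV (flatten-matchPairs-↭ contractedOrientation MH)) ⟩
        parity isV (allFin M) ∧ defect i
          ≡⟨ cong (_∧ defect i) (parity-≟-unique v (Unique.allFin⁺ M) (∈-allFin v)) ⟩
        defect i ∎
        where open ≡-Reasoning

      inversionParity-Q : inversionParity ltᶠ (flatten Q) ≡ inversionParity ltᶠ (flatten pairsH)
      inversionParity-Q = begin
        inversionParity ltᶠ (flatten Q)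
          ≡⟨ inversionParity-orient ltᶠ-strictTotal o Q₀ Q₀-unique ⟩
        inversionParity ltᶠ (flatten Q₀) xor misoriented o Q₀
          ≡⟨ cong₂ _xor_ (cong (inversionParity ltᶠ) flatten-Q₀) (parity-++ _ expandedPairs (pathPairs i)) ⟩
        inversionParity ltᶠ (map e sH ++ P) xor (misoriented o expandedPairs xor F)
          ≡⟨ cong₂ _xor_ (inversionParity-++ ltᶠ (map e sH) P) (cong (_xor F) misoriented-expandedPairs) ⟩
        ((inversionParity ltᶠ (map e sH) xor IP) xor crossParity ltᶠ (map e sH) P) xor (defect i xor F)
          ≡⟨ cong₂ (λ s x → ((s xor IP) xor x) xor (defect i xor F))
                   (inversionParity-map ltᶠ e sH) (parity-↭ (λ x → belowParity ltᶠ x P) (map⁺ e sH↭)) ⟩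
        ((inversionParity (expandedOrder i) sH xor IP) xor X) xor (defect i xor F)
          ≡⟨ cancel (orderDiscrepancy-↭ ltᶠ-strictTotal (ltᶠ-on-strictTotal e (expandAt-injective i))
                      (matchPairs-unique contractedOrientation MH) sH↭) ⟩
        inversionParity ltᶠ sH ∎
        where
        open ≡-Reasoning
        e = expandAt i
        sH = flatten pairsH
        sH↭ = flatten-matchPairs-↭ contractedOrientation MH
        P = flatten (pathPairs i)
        IP = inversionParity ltᶠ P
        X = crossParity ltᶠ (map e (allFin M)) P
        F = misoriented o (pathPairs i)
        cancel : ∀ {s t ip x f od} → s xor t ≡ od → ((t xor ip) xor x) xor ((((od xor ip) xor x) xor f) xor f) ≡ s
        cancel {s} {t} {ip} {x} {f} refl =
          solve 5 (λ s t ip x f → ((t :+ ip) :+ x) :+ (((((s :+ t) :+ ip) :+ x) :+ f) :+ f) := s) refl s t ip x f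

      sign-lift : sign o lift ≡ sign contractedOrientation MH
      sign-lift = begin
        sign o lift                                 ≡⟨ sign-fromPairs G-sym Q Q-unique Q-covers Q-edges o ori Q-directed ⟩
        bit (inversionParity ltᶠ (flatten Q))       ≡⟨ cong bit inversionParity-Q ⟩
        bit (inversionParity ltᶠ (flatten pairsH))  ≡⟨ sign≡inversionParity contractedOrientation MH ⟨
        sign contractedOrientation MH               ∎
        where open ≡-Reasoning

  Pfaffian-contraction : Pfaffian G → Pfaffian H
  Pfaffian-contraction (o , ori , same-sign) =
    contractedOrientation o ori , contractedOrientation-isOrientation o ori ,
    λ M₁ M₂ → trans (sym (Lift.sign-lift o ori M₁)) (trans (same-sign _ _) (Lift.sign-lift o ori M₂))

open OddCircuitContraction using (Pfaffian-contraction)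

-- Deleting an edge

module _ {n : ℕ} where

  SameEdge : Fin n → Fin n → Fin n → Fin n → Set
  SameEdge u w x y = (x ≡ u × y ≡ w) ⊎ (x ≡ w × y ≡ u)

  sameEdge? : ∀ u w x y → Dec (SameEdge u w x y)
  sameEdge? u w x y = ((x ≟ u) ×-dec (y ≟ w)) ⊎-dec ((x ≟ w) ×-dec (y ≟ u))

  SameEdge-swap : ∀ {u w x y} → SameEdge u w x y → SameEdge u w y x
  SameEdge-swap (inj₁ (x≡u , y≡w)) = inj₂ (y≡w , x≡u)
  SameEdge-swap (inj₂ (x≡w , y≡u)) = inj₁ (y≡u , x≡w)

  isDec≡does : ∀ (x y : Fin n) → isDec x y ≡ does (x ≟ y)
  isDec≡does x y with x ≟ y
  ... | yes _ = refl
  ... | no _ = refl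

  module _ (G : Graph n) {u w : Fin n} where

    deleteEdge-same : ∀ {x y} → SameEdge u w x y → deleteEdge G u w x y ≡ false
    deleteEdge-same (inj₁ (refl , refl)) rewrite isDec≡does u u | isDec≡does w w with u ≟ u | w ≟ w
    ... | yes _ | yes _ = refl
    ... | no u≢u | _ with () ← u≢u refl
    ... | _ | no w≢w with () ← w≢w refl
    deleteEdge-same (inj₂ (refl , refl)) rewrite isDec≡does w w | isDec≡does u u with w ≟ w | u ≟ u
    ... | yes _ | yes _ = if-idem (if isDec w u then isDec u w else false) false
    ... | no w≢w | _ with () ← w≢w refl
    ... | _ | no u≢u with () ← u≢u refl

    deleteEdge-other : ∀ {x y} → ¬ SameEdge u w x y → deleteEdge G u w x y ≡ G x y
    deleteEdge-other {x} {y} other rewrite isDec≡does x u | isDec≡does y w | isDec≡does x w | isDec≡does y u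
      with x ≟ u | y ≟ w | x ≟ w | y ≟ u
    ... | yes x≡u | yes y≡w | _ | _ with () ← other (inj₁ (x≡u , y≡w))
    ... | _ | _ | yes x≡w | yes y≡u with () ← other (inj₂ (x≡w , y≡u))
    ... | yes _ | no _ | yes _ | no _ = refl
    ... | yes _ | no _ | no _ | _ = refl
    ... | no _ | _ | yes _ | no _ = refl
    ... | no _ | _ | no _ | _ = refl

    deleteEdge-sym : (∀ a b → G a b ≡ G b a) → ∀ a b → deleteEdge G u w a b ≡ deleteEdge G u w b a
    deleteEdge-sym G-sym a b with sameEdge? u w a b
    ... | yes same = trans (deleteEdge-same same) (sym (deleteEdge-same (SameEdge-swap same)))
    ... | no other = trans (deleteEdge-other other)
                       (trans (G-sym a b) (sym (deleteEdge-other (λ same → other (SameEdge-swap same)))))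

    deleteEdge-⊆ : ∀ {x y} → deleteEdge G u w x y ≡ true → G x y ≡ true
    deleteEdge-⊆ {x} {y} e with sameEdge? u w x y
    ... | yes same with () ← trans (sym e) (deleteEdge-same same)
    ... | no other = trans (sym (deleteEdge-other other)) e

-- Degrees

module _ {n : ℕ} (G : Graph n) where

  neighbours : Fin n → List (Fin n)
  neighbours u = filter (λ w → G u w ≟ᵇ true) (allFin n)

  deg≡length-neighbours : ∀ u → deg G u ≡ length (neighbours u)
  deg≡length-neighbours u = count (allFin n)
    where
    count : ∀ xs → sum (map (λ w → if G u w then 1 else 0) xs) ≡ length (filter (λ w → G u w ≟ᵇ true) xs)
    count [] = refl
    count (x ∷ xs) with G u x
    ... | true = cong suc (count xs)
    ... | false = count xs

  ∈-neighbours⁺ : ∀ {u w} → G u w ≡ true → w ∈ neighbours u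
  ∈-neighbours⁺ {u} {w} g = ∈-filter⁺ (λ w → G u w ≟ᵇ true) (∈-allFin w) g

  ∈-neighbours⁻ : ∀ {u w} → w ∈ neighbours u → G u w ≡ true
  ∈-neighbours⁻ {u} w∈ = proj₂ (∈-filter⁻ (λ w → G u w ≟ᵇ true) {xs = allFin n} w∈)

  neighbours-unique : ∀ u → Unique (neighbours u)
  neighbours-unique u = Unique.filter⁺ (λ w → G u w ≟ᵇ true) (Unique.allFin⁺ n)

module MinimalNonPfaffianContraction
  {N M m : ℕ} {G : Graph N} {c : Fin (suc (m + m)) → Fin N} {H : Graph M} {φ : Fin N → Fin M} {v : Fin M}
  (minimal : MinimalNonPfaffian G) (circuit : IsCircuit G c) (contraction : IsContraction G c H φ v)
  (H-nonPfaffian : ¬ Pfaffian H)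
  where

  open IsContraction contraction
  open IsCircuit circuit

  G-sym : ∀ a b → G a b ≡ G b a
  G-sym = IsSimple.sym (proj₁ minimal)

  φ-c : ∀ i → φ (c i) ≡ v
  φ-c i = onC (c i) (i , refl)

  ImageRealisedWithout : Fin N → Fin N → Fin N → Fin N → Set
  ImageRealisedWithout u w a b =
    ∃ λ a′ → ∃ λ b′ → φ a′ ≡ φ a × φ b′ ≡ φ b × G a′ b′ ≡ true × ¬ SameEdge u w a′ b′

  -- G - uw is Pfaffian by minimality, and still has C as a circuit and H as its contraction.
  no-inessential-edge : ∀ {u w} → G u w ≡ true →
    (∀ i → ¬ SameEdge u w (c i) (c (cycNext i))) →
    (∀ {a b} → G a b ≡ true → φ a ≢ φ b → SameEdge u w a b → ImageRealisedWithout u w a b) → ⊥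
  no-inessential-edge {u} {w} guw off-circuit reroute =
    H-nonPfaffian (Pfaffian-contraction {m = m} (deleteEdge-sym G G-sym) circuit′ contraction′
      (proj₂ (proj₂ minimal) u w guw))
    where
    circuit′ : IsCircuit (deleteEdge G u w) c
    circuit′ = record { long = long ; inject = inject
                      ; edges = λ i → trans (deleteEdge-other G (off-circuit i)) (edges i) }
    adjTo′ : ∀ y z → H y z ≡ true →
      (y ≢ z) × (∃ λ a → ∃ λ b → φ a ≡ y × φ b ≡ z × deleteEdge G u w a b ≡ true)
    adjTo′ y z h with adjTo y z h
    ... | y≢z , a , b , refl , refl , gab with sameEdge? u w a b
    ...   | no other = y≢z , a , b , refl , refl , trans (deleteEdge-other G other) gab
    ...   | yes same with reroute gab y≢z same
    ...     | a′ , b′ , φa′ , φb′ , ga′b′ , other =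
      y≢z , a′ , b′ , φa′ , φb′ , trans (deleteEdge-other G other) ga′b′
    contraction′ : IsContraction (deleteEdge G u w) c H φ v
    contraction′ = record
      { onC = onC ; offC = offC ; injOff = injOff ; surj = surj ; adjTo = adjTo′
      ; adjFrom = λ y z y≢z a b φa φb g → adjFrom y z y≢z a b φa φb (deleteEdge-⊆ G g) }

  no-chord : ∀ i j → G (c i) (c j) ≡ true → j ≡ cycNext i ⊎ i ≡ cycNext j
  no-chord i j g with j ≟ cycNext i | i ≟ cycNext j
  ... | yes j≡i⁺ | _ = inj₁ j≡i⁺
  ... | no _ | yes i≡j⁺ = inj₂ i≡j⁺
  ... | no j≢i⁺ | no i≢j⁺ = ⊥-elim (no-inessential-edge g off-circuit inside-C)
    where
    off-circuit : ∀ k → ¬ SameEdge (c i) (c j) (c k) (c (cycNext k))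
    off-circuit k (inj₁ (ck≡ci , ck⁺≡cj)) =
      j≢i⁺ (trans (sym (inject _ _ ck⁺≡cj)) (cong cycNext (inject _ _ ck≡ci)))
    off-circuit k (inj₂ (ck≡cj , ck⁺≡ci)) =
      i≢j⁺ (trans (sym (inject _ _ ck⁺≡ci)) (cong cycNext (inject _ _ ck≡cj)))
    inside-C : ∀ {a b} → G a b ≡ true → φ a ≢ φ b → SameEdge (c i) (c j) a b → ImageRealisedWithout (c i) (c j) a b
    inside-C _ φa≢φb (inj₁ (refl , refl)) with () ← φa≢φb (trans (φ-c i) (sym (φ-c j)))
    inside-C _ φa≢φb (inj₂ (refl , refl)) with () ← φa≢φb (trans (φ-c j) (sym (φ-c i)))

  one-neighbour-on-C : ∀ x → ¬ InC c x → ∀ i j → G x (c i) ≡ true → G x (c j) ≡ true → i ≡ j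
  one-neighbour-on-C x x∉C i j gi gj with i ≟ j
  ... | yes i≡j = i≡j
  ... | no i≢j = ⊥-elim (no-inessential-edge gi off-circuit through-c-j)
    where
    off-circuit : ∀ k → ¬ SameEdge x (c i) (c k) (c (cycNext k))
    off-circuit k (inj₁ (ck≡x , _)) = x∉C (k , ck≡x)
    off-circuit k (inj₂ (_ , ck⁺≡x)) = x∉C (cycNext k , ck⁺≡x)
    through-c-j : ∀ {a b} → G a b ≡ true → φ a ≢ φ b → SameEdge x (c i) a b → ImageRealisedWithout x (c i) a b
    through-c-j _ _ (inj₁ (refl , refl)) =
      x , c j , refl , trans (φ-c j) (sym (φ-c i)) , gj ,
      λ { (inj₁ (_ , cj≡ci)) → i≢j (sym (inject _ _ cj≡ci)) ; (inj₂ (x≡ci , _)) → x∉C (i , sym x≡ci) }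
    through-c-j _ _ (inj₂ (refl , refl)) =
      c j , x , trans (φ-c j) (sym (φ-c i)) , refl , trans (G-sym (c j) x) gj ,
      λ { (inj₁ (cj≡x , _)) → x∉C (j , cj≡x) ; (inj₂ (cj≡ci , _)) → i≢j (sym (inject _ _ cj≡ci)) }

  inC? : ∀ x → Dec (InC c x)
  inC? x = any? (λ i → c i ≟ x)

  deg-outside : ∀ w → ¬ InC c w → deg G w ≡ deg H (φ w)
  deg-outside w w∉C = begin
    deg G w                          ≡⟨ deg≡length-neighbours G w ⟩
    length (neighbours G w)          ≡⟨ length-map φ (neighbours G w) ⟨
    length (map φ (neighbours G w))  ≡⟨ ↭-length image-↭ ⟩
    length (neighbours H (φ w))      ≡⟨ deg≡length-neighbours H (φ w) ⟨
    deg H (φ w)                      ∎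
    where
    open ≡-Reasoning
    φ-injective-on : ∀ {x y} → x ∈ neighbours G w → y ∈ neighbours G w → φ x ≡ φ y → x ≡ y
    φ-injective-on {x} {y} x∈ y∈ e with inC? x | inC? y
    ... | no x∉C | no y∉C = injOff x y x∉C y∉C e
    ... | yes (i , refl) | yes (j , refl) =
      cong c (one-neighbour-on-C w w∉C i j (∈-neighbours⁻ G x∈) (∈-neighbours⁻ G y∈))
    ... | yes (i , refl) | no y∉C = ⊥-elim (offC y y∉C (trans (sym e) (φ-c i)))
    ... | no x∉C | yes (j , refl) = ⊥-elim (offC x x∉C (trans e (φ-c j)))
    φw≢φx : ∀ {x} → G w x ≡ true → φ w ≢ φ x
    φw≢φx {x} g e with inC? x
    ... | yes x∈C = offC w w∉C (trans e (onC x x∈C))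
    ... | no x∉C with refl ← injOff w x w∉C x∉C e with () ← trans (sym g) (IsSimple.irrefl (proj₁ minimal) w)
    image⊆ : ∀ {z} → z ∈ map φ (neighbours G w) → z ∈ neighbours H (φ w)
    image⊆ z∈ with ∈-map⁻ φ z∈
    ... | x , x∈ , refl =
      ∈-neighbours⁺ H (adjFrom (φ w) (φ x) (φw≢φx (∈-neighbours⁻ G x∈)) w x refl refl (∈-neighbours⁻ G x∈))
    ⊆image : ∀ {z} → z ∈ neighbours H (φ w) → z ∈ map φ (neighbours G w)
    ⊆image z∈ with adjTo (φ w) _ (∈-neighbours⁻ H z∈)
    ... | _ , a , b , φa≡φw , refl , gab with inC? a
    ...   | yes a∈C = ⊥-elim (offC w w∉C (trans (sym φa≡φw) (onC a a∈C)))
    ...   | no a∉C with refl ← injOff a w a∉C w∉C φa≡φw = ∈-map⁺ φ (∈-neighbours⁺ G gab)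
    image-↭ : map φ (neighbours G w) ↭ neighbours H (φ w)
    image-↭ = unique-↭ (Unique-map⁺-on φ φ-injective-on (neighbours-unique G w)) (neighbours-unique H (φ w))
                image⊆ ⊆image

  outsideNeighbours : Fin (suc (m + m)) → List (Fin N)
  outsideNeighbours i = filter (λ x → ¬? (inC? x)) (neighbours G (c i))

  ∈-outsideNeighbours⁻ : ∀ {i x} → x ∈ outsideNeighbours i → G (c i) x ≡ true × ¬ InC c x
  ∈-outsideNeighbours⁻ {i} x∈ with ∈-filter⁻ (λ x → ¬? (inC? x)) {xs = neighbours G (c i)} x∈
  ... | x∈′ , x∉C = ∈-neighbours⁻ G x∈′ , x∉C

  ∈-outsideNeighbours⁺ : ∀ {i x} → G (c i) x ≡ true → ¬ InC c x → x ∈ outsideNeighbours i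
  ∈-outsideNeighbours⁺ g x∉C = ∈-filter⁺ (λ x → ¬? (inC? x)) (∈-neighbours⁺ G g) x∉C

  outsideNeighbours-unique : ∀ i → Unique (outsideNeighbours i)
  outsideNeighbours-unique i = Unique.filter⁺ (λ x → ¬? (inC? x)) (neighbours-unique G (c i))

  neighbours-on-C-↭ : ∀ i → neighbours G (c i) ↭ c (cycNext i) ∷ c (cycPrev i) ∷ outsideNeighbours i
  neighbours-on-C-↭ i = unique-↭ (neighbours-unique G (c i)) unique ⊆split split⊆
    where
    ∉outside : ∀ j → c j ∉ outsideNeighbours i
    ∉outside j cj∈ = proj₂ (∈-outsideNeighbours⁻ cj∈) (j , refl)
    unique : Unique (c (cycNext i) ∷ c (cycPrev i) ∷ outsideNeighbours i)
    unique = ((λ e → cycNext≢cycPrev (ℕ.≤-pred long) i (inject _ _ e)) ∷ All.¬Any⇒All¬ _ (∉outside (cycNext i)))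
           ∷ All.¬Any⇒All¬ _ (∉outside (cycPrev i))
           ∷ outsideNeighbours-unique i
    ⊆split : ∀ {x} → x ∈ neighbours G (c i) → x ∈ c (cycNext i) ∷ c (cycPrev i) ∷ outsideNeighbours i
    ⊆split {x} x∈ with inC? x
    ... | no x∉C = there (there (∈-outsideNeighbours⁺ (∈-neighbours⁻ G x∈) x∉C))
    ... | yes (j , refl) with no-chord i j (∈-neighbours⁻ G x∈)
    ...   | inj₁ j≡i⁺ = here (cong c j≡i⁺)
    ...   | inj₂ i≡j⁺ = there (here (cong c (trans (sym (cycPrev-cycNext j)) (cong cycPrev (sym i≡j⁺)))))
    split⊆ : ∀ {x} → x ∈ c (cycNext i) ∷ c (cycPrev i) ∷ outsideNeighbours i → x ∈ neighbours G (c i)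
    split⊆ (here refl) = ∈-neighbours⁺ G (edges i)
    split⊆ (there (here refl)) = ∈-neighbours⁺ G (trans (G-sym (c i) (c (cycPrev i)))
      (subst (λ t → G (c (cycPrev i)) (c t) ≡ true) (cycNext-cycPrev i) (edges (cycPrev i))))
    split⊆ (there (there x∈)) = ∈-neighbours⁺ G (proj₁ (∈-outsideNeighbours⁻ x∈))

  deg-on-C : ∀ i → deg G (c i) ≡ 2 + length (outsideNeighbours i)
  deg-on-C i = trans (deg≡length-neighbours G (c i)) (↭-length (neighbours-on-C-↭ i))

  neighbours-v-↭ : map φ (concatMap outsideNeighbours (allFin (suc (m + m)))) ↭ neighbours H v
  neighbours-v-↭ = unique-↭ (Unique-map⁺-on φ (λ x∈ y∈ → injOff _ _ (∉C x∈) (∉C y∈)) outside-unique)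
    (neighbours-unique H v) image⊆ ⊆image
    where
    ∉C : ∀ {x} → x ∈ concatMap outsideNeighbours (allFin (suc (m + m))) → ¬ InC c x
    ∉C x∈ = proj₂ (∈-outsideNeighbours⁻
      (proj₂ (Any.satisfied (∈-concatMap⁻ outsideNeighbours {xs = allFin (suc (m + m))} x∈))))
    disjoint : ∀ {i j} → i ≢ j → Disjoint (outsideNeighbours i) (outsideNeighbours j)
    disjoint {i} {j} i≢j (x∈i , x∈j) with ∈-outsideNeighbours⁻ x∈i | ∈-outsideNeighbours⁻ x∈j
    ... | gi , x∉C | gj , _ = i≢j (one-neighbour-on-C _ x∉C i j (trans (G-sym _ _) gi) (trans (G-sym _ _) gj))
    outside-unique : Unique (concatMap outsideNeighbours (allFin (suc (m + m))))
    outside-unique = Unique.concat⁺ (All.map⁺ (All.tabulate (λ {i} _ → outsideNeighbours-unique i)))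
      (AllPairs.map⁺ (AllPairs.map disjoint (Unique.allFin⁺ (suc (m + m)))))
    image⊆ : ∀ {z} → z ∈ map φ (concatMap outsideNeighbours (allFin (suc (m + m)))) → z ∈ neighbours H v
    image⊆ z∈ with ∈-map⁻ φ z∈
    ... | x , x∈ , refl with Any.satisfied (∈-concatMap⁻ outsideNeighbours {xs = allFin (suc (m + m))} x∈)
    ...   | i , x∈i with ∈-outsideNeighbours⁻ x∈i
    ...     | g , x∉C =
      ∈-neighbours⁺ H (adjFrom v (φ x) (λ v≡φx → offC x x∉C (sym v≡φx)) (c i) x (φ-c i) refl g)
    ⊆image : ∀ {z} → z ∈ neighbours H v → z ∈ map φ (concatMap outsideNeighbours (allFin (suc (m + m))))
    ⊆image z∈ with adjTo v _ (∈-neighbours⁻ H z∈)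
    ... | v≢z , a , b , φa≡v , refl , gab with φ≡v⇒InC contraction a φa≡v
    ...   | i , refl = ∈-map⁺ φ (∈-concatMap⁺ outsideNeighbours
            (lose (∈-allFin i) (∈-outsideNeighbours⁺ gab (λ b∈C → v≢z (trans (sym (onC b b∈C)) refl)))))

  deg-contracted : deg H v + 2 * suc (m + m) ≡ sum (map (λ i → deg G (c i)) (allFin (suc (m + m))))
  deg-contracted = begin
    deg H v + 2 * K                       ≡⟨ cong (_+ 2 * K) deg-v ⟩
    sum (map L (allFin K)) + 2 * K        ≡⟨ ℕ.+-comm (sum (map L (allFin K))) (2 * K) ⟩
    2 * K + sum (map L (allFin K))
      ≡⟨ cong (λ n → 2 * n + sum (map L (allFin K))) (length-tabulate {n = K} (λ i → i)) ⟨
    2 * length (allFin K) + sum (map L (allFin K)) ≡⟨ sum-map-2+ L (allFin K) ⟨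
    sum (map (λ i → 2 + L i) (allFin K))  ≡⟨ cong sum (map-cong (λ i → sym (deg-on-C i)) (allFin K)) ⟩
    sum (map (λ i → deg G (c i)) (allFin K)) ∎
    where
    open ≡-Reasoning
    K = suc (m + m)
    L : Fin K → ℕ
    L i = length (outsideNeighbours i)
    deg-v : deg H v ≡ sum (map L (allFin K))
    deg-v = begin
      deg H v                                        ≡⟨ deg≡length-neighbours H v ⟩
      length (neighbours H v)                        ≡⟨ ↭-length neighbours-v-↭ ⟨
      length (map φ (concatMap outsideNeighbours (allFin K)))
        ≡⟨ length-map φ (concatMap outsideNeighbours (allFin K)) ⟩
      length (concatMap outsideNeighbours (allFin K)) ≡⟨ length-concatMap outsideNeighbours (allFin K) ⟩
      sum (map L (allFin K))                         ∎

mainTheorem7 : ∀ {N k M : ℕ} (G : Graph N) (c : Fin k → Fin N)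
                 (H : Graph M) (φ : Fin N → Fin M) (v : Fin M) →
                 MinimalNonPfaffian G → IsCircuit G c → k % 2 ≡ 1 →
                 IsContraction G c H φ v → ¬ Pfaffian H →
                 (deg H v + 2 * k ≡ sum (map (λ i → deg G (c i)) (allFin k)))
                 × (∀ w → ¬ InC c w → (φ w ≢ v) × (deg G w ≡ deg H (φ w)))
mainTheorem7 {k = k} G c H φ v minimal circuit odd contraction H-nonPfaffian with n%2≡1⇒n≡suc[m+m] k odd
... | m , refl = deg-contracted , λ w w∉C → IsContraction.offC contraction w w∉C , deg-outside w w∉C
  where open MinimalNonPfaffianContraction {m = m} minimal circuit contraction H-nonPfaffian
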